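{- Let $\phi=\tau^0\mbox{ - }\ell\mbox{ - }\tau^1$ be a shuffle pattern (with $\tau^0,\tau^1$ generalized patterns with no hyphens, $\ell$ greater than all letters of $\tau^0$ and $\tau^1$, and letters of $\tau^0$ incomparable with letters of $\tau^1$), and let $f(\phi)=f_1(\tau^0)\mbox{ - }\ell\mbox{ - }f_2(\tau^1)$ (a shuffle pattern of the same kind), where $f_1,f_2$ are any trivial bijections. Then $\phi\equiv f(\phi)$.
   Context: $[k]^n$ = words of length $n$ over $\{1,\dots,k\}$. A generalized pattern with no hyphens is a word over $[m]$ using every letter of $[m]$. A partially ordered generalized pattern (POGP) has letters from a partially ordered set, possibly with hyphens between consecutive letters; a word $\sigma$ contains a POGP $\pi=\pi_1\cdots\pi_r$ if there are indices $i_1<\dots<i_r$ with $i_{j+1}=i_j+1$ whenever $\pi_j,\pi_{j+1}$ are not separated by a hyphen, and for every pair of positions whose letters are comparable (identical letters are equal) the corresponding letters of $\sigma$ stand in the same relation ($<,=,>$); incomparable pairs are unconstrained. Otherwise $\sigma$ avoids $\pi$. Two POGPs are equivalent ($\equiv$) if for every $k$ and $n$ the numbers of words in $[k]^n$ avoiding them are equal. Trivial bijections are the reverse $R(\sigma_1\cdots\sigma_n)=\sigma_n\cdots\sigma_1$, the complement $C$ (replacing each letter $a$ by $M+1-a$, where $M$ is the largest letter of the alphabet, e.g. $M=k$ for words in $[k]^n$ and the largest letter of a pattern for patterns), and the composition $R\circ C$. -}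

module Defs where

open import Data.Nat using (ℕ; zero; suc; _+_; _<_; _<ᵇ_; _≡ᵇ_)
open import Data.Fin using (Fin; toℕ; splitAt; opposite)
open import Data.Fin.Base using () renaming (_<_ to _<ᶠ_)
open import Data.Vec using (Vec; lookup)
open import Data.Bool using (Bool; true; false; _∨_; if_then_else_)
open import Data.Maybe using (Maybe; just; nothing)
open import Data.Product using (Σ; ∃; _×_; _,_)
open import Data.Sum using (inj₁; inj₂)
open import Relation.Binary.PropositionalEquality using (_≡_)
open import Relation.Nullary using (¬_)
open import Function.Bundles using (_↔_; Inverse)
open import Function.Definitions using (Surjective)

data Rel3 : Set where
  LT EQ GT : Rel3

Holds : Rel3 → ℕ → ℕ → Set
Holds LT x y = x < y
Holds EQ x y = x ≡ y
Holds GT x y = y < x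

ord : ℕ → ℕ → Rel3
ord x y = if x <ᵇ y then LT else (if x ≡ᵇ y then EQ else GT)

-- A POGP of length len has letters  letter i  (i : Fin len) taken from a
-- poset given by the partial comparison  cmp : Letter → Letter → Maybe Rel3
-- (nothing = incomparable).  glued i = true means that letters i and i+1
-- are NOT separated by a hyphen (for the last letter the value is irrelevant).

record POGP : Set₁ where
  field
    Letter : Set
    cmp    : Letter → Letter → Maybe Rel3
    len    : ℕ
    letter : Fin len → Letter
    glued  : Fin len → Bool

open POGP public

Contains : (π : POGP) {k n : ℕ} → Vec (Fin k) n → Set
Contains π {k} {n} σ =
  Σ (Fin (len π) → Fin n) λ ι →
      (∀ i j → i <ᶠ j → ι i <ᶠ ι j)
    × (∀ i j → toℕ j ≡ suc (toℕ i) → glued π i ≡ true →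
         toℕ (ι j) ≡ suc (toℕ (ι i)))
    × (∀ i j o → cmp π (letter π i) (letter π j) ≡ just o →
         Holds o (toℕ (lookup σ (ι i))) (toℕ (lookup σ (ι j))))

Avoids : (π : POGP) {k n : ℕ} → Vec (Fin k) n → Set
Avoids π σ = ¬ Contains π σ

-- π ≡ π' : for all k, n the numbers of words in [k]^n avoiding π and π'
-- coincide; expressed as: there is a bijection of the finite set [k]^n onto
-- itself carrying the π-avoiders exactly onto the π'-avoiders.
_≡ₚ_ : POGP → POGP → Set
π ≡ₚ π' = ∀ (k n : ℕ) →
  Σ (Vec (Fin k) n ↔ Vec (Fin k) n) λ g →
    ∀ σ → (Avoids π σ → Avoids π' (Inverse.to g σ))
        × (Avoids π' (Inverse.to g σ) → Avoids π σ)

-- Generalized patterns without hyphens: a word τ of length r over [m]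
-- using every letter of [m] (surjectivity of τ : Fin r → Fin m).

IsGenPattern : {r m : ℕ} → (Fin r → Fin m) → Set
IsGenPattern τ = Surjective _≡_ _≡_ τ

data TrivBij : Set where
  idB revB compB revcompB : TrivBij

-- R: reverse; C: complement a ↦ m+1-a (m = largest letter = m since τ
-- uses all letters of [m]); R∘C.
applyTB : TrivBij → {r m : ℕ} → (Fin r → Fin m) → (Fin r → Fin m)
applyTB idB      τ i = τ i
applyTB revB     τ i = τ (opposite i)
applyTB compB    τ i = opposite (τ i)
applyTB revcompB τ i = opposite (τ (opposite i))

-- letters: left x (from τ⁰), right y (from τ¹), and the top letter ℓ
data SLetter : Set where
  left right : ℕ → SLetter
  top        : SLetter

cmpS : SLetter → SLetter → Maybe Rel3
cmpS (left x)  (left y)  = just (ord x y)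
cmpS (right x) (right y) = just (ord x y)
cmpS (left _)  (right _) = nothing
cmpS (right _) (left _)  = nothing
cmpS top       top       = just EQ
cmpS top       _         = just GT
cmpS _         top       = just LT

shuffle : {r₀ r₁ m₀ m₁ : ℕ} → (Fin r₀ → Fin m₀) → (Fin r₁ → Fin m₁) → POGP
shuffle {r₀} {r₁} τ⁰ τ¹ = record
  { Letter = SLetter
  ; cmp    = cmpS
  ; len    = r₀ + suc r₁
  ; letter = lt
  ; glued  = λ i → (suc (toℕ i) <ᵇ r₀) ∨ (r₀ <ᵇ toℕ i)
  }
  where
  lt : Fin (r₀ + suc r₁) → SLetter
  lt i with splitAt r₀ i
  ... | inj₁ p           = left (toℕ (τ⁰ p))
  ... | inj₂ Fin.zero    = top
  ... | inj₂ (Fin.suc q) = right (toℕ (τ¹ q))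

module Submission where

-- σ contains τ⁰-ℓ-τ¹ iff σ = α x β where α has a factor order-isomorphic to τ⁰, β has one
-- order-isomorphic to τ¹, and all letters of both factors are smaller than x.  Reversing and
-- complementing words turns occurrences of τ into occurrences of R τ and C τ, so it suffices to
-- replace one factor at a time: given length-preserving bijections of [k]* (for every k) carrying
-- the words that contain P onto those that contain Q, build one carrying the words that contain
-- P-ℓ-p onto those that contain Q-ℓ-p.  Reversing words reduces the right factor to the left one.
--
-- This goes by induction on the alphabet.  A word over [K+1] is a sequence of blocks over [K]
-- separated by the letter K.  If its first block contains P, the word contains P-ℓ-p iff that
-- block does or the rest of the word contains p below K; otherwise iff the rest does.  So map
-- the blocks before the first block containing P by the given bijection F, map that block (or
-- the last one, if none contains P) by a bijection H, and keep the rest.  H has to preserve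
-- containing P and containing P-ℓ-p at the same time; it exists by counting, because F matches
-- the words of each length avoiding P and the induction hypothesis matches those containing
-- P-ℓ-p, so the remaining words of each length, which contain P but not P-ℓ-p, are equinumerous
-- as well.

open import Axiom.UniquenessOfIdentityProofs using (module Decidable⇒UIP)
open import Data.Bool using (Bool; true; false; T; if_then_else_)
import Data.Bool.Properties as Bool
open import Data.Bool.Properties using (T-≡; T-∨)
open import Data.Empty using (⊥; ⊥-elim)
open import Data.Fin using (Fin; toℕ; zero; suc; opposite; inject₁; fromℕ; fromℕ<; _↑ˡ_; _↑ʳ_; splitAt)
open import Data.Fin.Properties
  using (toℕ<n; toℕ≤pred[n]; toℕ-inject₁; toℕ-fromℕ; toℕ-fromℕ<; fromℕ<-toℕ; opposite-prop; opposite-involutive;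
         toℕ-↑ˡ; toℕ-↑ʳ; splitAt-↑ˡ; splitAt-↑ʳ; splitAt⁻¹-↑ˡ; splitAt⁻¹-↑ʳ; all?; +↔⊎; cantor-schröder-bernstein)
open import Data.Fin.Relation.Unary.Top using (view; ‵fromℕ; ‵inj₁; view-fromℕ; view-inject₁)
open import Data.List using (List; []; _∷_; _++_; length; map; reverse; take; drop)
open import Data.List.NonEmpty using (List⁺; _∷_; _∷⁺_; head; tail)
open import Data.List.Properties
  using (++-assoc; ++-identityʳ; ∷-injective; map-++; map-∘; map-cong; map-id; length-map; length-++;
         reverse-++; reverse-involutive; length-reverse; unfold-reverse; reverse-map; take++drop≡id; length-take; length-drop)
open import Data.List.Relation.Unary.All as All using (All; []; _∷_)
import Data.List.Relation.Unary.All.Properties as All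
open import Data.Maybe using (just)
open import Data.Maybe.Properties using (just-injective)
open import Data.Nat using (ℕ; zero; suc; _+_; _∸_; _^_; _<_; _≤_; _<ᵇ_; _<?_; s≤s; z≤n; s≤s⁻¹)
import Data.Nat.Properties as ℕ
open import Data.Product using (Σ; Σ-syntax; ∃-syntax; ∃₂; _×_; _,_; proj₁; proj₂)
open import Data.Product.Function.Dependent.Propositional using (Σ-↔)
open import Data.Product.Properties using (≡-dec)
open import Data.Sum using (_⊎_; inj₁; inj₂; [_,_])
open import Data.Sum.Function.Propositional using (_⊎-↔_; _⊎-⇔_)
open import Data.Vec using (Vec; []; _∷_; lookup; toList; fromList; cast)
open import Data.Vec.Properties using (toList∘fromList; fromList∘toList; length-toList; cast-is-id)
open import Data.Vec.Recursive using (fromVec; toVec; Fin[m^n]↔Fin[m]^n)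
open import Data.Vec.Recursive.Properties using (fromVec∘toVec; toVec∘fromVec)
open import Function using (_∘_; id; case_of_)
open import Function.Bundles using (_↔_; Inverse; mk↔ₛ′; Injection; _⇔_; mk⇔; Equivalence)
open import Function.Construct.Composition using (_⇔-∘_)
open import Function.Construct.Identity using (⇔-id)
open import Function.Construct.Symmetry using (⇔-sym)
open import Function.Properties.Inverse using (↔-refl; ↔-sym; ↔-trans; ↔⇒↣)
open import Function.Related.Propositional using (module EquationalReasoning)
open import Function.Related.TypeIsomorphisms using (⊎-comm; ¬-cong-⇔)
open import Relation.Binary using (tri<; tri≈; tri>)
open import Relation.Binary.Definitions using (DecidableEquality)
open import Relation.Binary.PropositionalEquality hiding ([_])
open import Relation.Nullary using (Dec; yes; no; does; ¬_)
open import Relation.Nullary.Decidable using (_×-dec_; map′; dec-true; dec-false)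
open import Relation.Unary using (Decidable)
open import Defs

open Inverse

-- out of range, at returns 0; it is only ever used in range
at : List ℕ → ℕ → ℕ
at [] _ = 0
at (x ∷ xs) zero = x
at (x ∷ xs) (suc i) = at xs i

at-++ˡ : ∀ xs ys {i} → i < length xs → at (xs ++ ys) i ≡ at xs i
at-++ˡ (x ∷ xs) ys {zero} _ = refl
at-++ˡ (x ∷ xs) ys {suc i} (s≤s i<xs) = at-++ˡ xs ys i<xs

at-++ʳ : ∀ xs ys i → at (xs ++ ys) (length xs + i) ≡ at ys i
at-++ʳ [] ys i = refl
at-++ʳ (x ∷ xs) ys i = at-++ʳ xs ys i

at-++-∷ : ∀ xs {y ys} → at (xs ++ y ∷ ys) (length xs) ≡ y
at-++-∷ [] = refl
at-++-∷ (x ∷ xs) = at-++-∷ xs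

at-take : ∀ {n} xs {j} → j < n → at (take n xs) j ≡ at xs j
at-take {suc n} [] _ = refl
at-take {suc n} (x ∷ xs) {zero} _ = refl
at-take {suc n} (x ∷ xs) {suc j} (s≤s j<n) = at-take xs j<n

at-drop : ∀ n xs j → at (drop n xs) j ≡ at xs (n + j)
at-drop zero xs j = refl
at-drop (suc n) [] j = refl
at-drop (suc n) (x ∷ xs) j = at-drop n xs j

at-map : ∀ (h : ℕ → ℕ) u {i} → i < length u → at (map h u) i ≡ h (at u i)
at-map h (x ∷ u) {zero} _ = refl
at-map h (x ∷ u) {suc i} (s≤s i<u) = at-map h u i<u

at-reverse : ∀ u {i} → i < length u → at (reverse u) i ≡ at u (length u ∸ suc i)
at-reverse (x ∷ u) {i} i<1+u rewrite unfold-reverse x u with ℕ.<-cmp i (length u)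
... | tri< i<u _ _ = begin
  at (reverse u ++ x ∷ []) i            ≡⟨ at-++ˡ (reverse u) (x ∷ []) (subst (i <_) (sym (length-reverse u)) i<u) ⟩
  at (reverse u) i                      ≡⟨ at-reverse u i<u ⟩
  at u (length u ∸ suc i)               ≡⟨ cong (at (x ∷ u)) (ℕ.+-∸-assoc 1 i<u) ⟨
  at (x ∷ u) (suc (length u) ∸ suc i)   ∎
  where open ≡-Reasoning
... | tri≈ _ refl _ = begin
  at (reverse u ++ x ∷ []) (length u)   ≡⟨ cong (at (reverse u ++ x ∷ [])) (length-reverse u) ⟨
  at (reverse u ++ x ∷ []) (length (reverse u)) ≡⟨ at-++-∷ (reverse u) ⟩
  x                                     ≡⟨ cong (at (x ∷ u)) (ℕ.n∸n≡0 (length u)) ⟨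
  at (x ∷ u) (length u ∸ length u)      ∎
  where open ≡-Reasoning
... | tri> _ _ u<i = ⊥-elim (ℕ.<-irrefl refl (ℕ.<-≤-trans u<i (s≤s⁻¹ i<1+u)))

All-at : ∀ {P : ℕ → Set} {u i} → All P u → i < length u → P (at u i)
All-at {i = zero} (px ∷ _) _ = px
All-at {i = suc i} (_ ∷ pu) (s≤s i<u) = All-at pu i<u

All-from-at : ∀ {P : ℕ → Set} {r u} → length u ≡ r → (∀ (i : Fin r) → P (at u (toℕ i))) → All P u
All-from-at {u = []} _ _ = []
All-from-at {u = x ∷ u} refl h = h zero ∷ All-from-at refl (λ i → h (suc i))

All-reverse : ∀ {P : ℕ → Set} {u} → All P u → All P (reverse u)
All-reverse {u = []} [] = []
All-reverse {u = x ∷ u} (px ∷ pu) = subst (All _) (sym (unfold-reverse x u)) (All.++⁺ (All-reverse pu) (px ∷ []))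

++-locate-∷ : {A : Set} (α μ xs : List A) (y : A) (ys : List A) → α ++ μ ≡ xs ++ y ∷ ys →
  (Σ[ γ ∈ List A ] xs ≡ α ++ γ × μ ≡ γ ++ y ∷ ys) ⊎ (Σ[ γ ∈ List A ] α ≡ xs ++ y ∷ γ × ys ≡ γ ++ μ)
++-locate-∷ [] μ xs y ys eq = inj₁ (xs , refl , eq)
++-locate-∷ (a ∷ α) μ [] y ys refl = inj₂ (α , refl , refl)
++-locate-∷ (a ∷ α) μ (x ∷ xs) y ys eq with ∷-injective eq
... | refl , eq′ with ++-locate-∷ α μ xs y ys eq′
...   | inj₁ (γ , refl , e) = inj₁ (γ , refl , e)
...   | inj₂ (γ , refl , e) = inj₂ (γ , refl , e)

++-∷-at : ∀ w {b} → b < length w → w ≡ take b w ++ at w b ∷ drop (suc b) w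
++-∷-at (x ∷ w) {zero} _ = refl
++-∷-at (x ∷ w) {suc b} (s≤s b<w) = cong (x ∷_) (++-∷-at w b<w)

ord-< : ∀ {x y} → x < y → ord x y ≡ LT
ord-< {zero} {suc y} _ = refl
ord-< {suc x} {suc y} (s≤s x<y) = ord-< x<y

ord-refl : ∀ x → ord x x ≡ EQ
ord-refl zero = refl
ord-refl (suc x) = ord-refl x

ord-> : ∀ {x y} → y < x → ord x y ≡ GT
ord-> {suc x} {zero} _ = refl
ord-> {suc x} {suc y} (s≤s y<x) = ord-> y<x

ord-∸ : ∀ {m a b} → a < m → b < m → ord (m ∸ suc a) (m ∸ suc b) ≡ ord b a
ord-∸ {m} {a} {b} a<m b<m with ℕ.<-cmp a b
... | tri< a<b _ _ = trans (ord-> (ℕ.∸-monoʳ-< {m} (s≤s a<b) b<m)) (sym (ord-> a<b))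
... | tri≈ _ refl _ = trans (ord-refl (m ∸ suc a)) (sym (ord-refl a))
... | tri> _ _ b<a = trans (ord-< (ℕ.∸-monoʳ-< {m} (s≤s b<a) a<m)) (sym (ord-< b<a))

holds-ord : ∀ x y → Holds (ord x y) x y
holds-ord x y with ℕ.<-cmp x y
... | tri< x<y _ _ = subst (λ o → Holds o x y) (sym (ord-< x<y)) x<y
... | tri≈ _ refl _ = subst (λ o → Holds o x x) (sym (ord-refl x)) refl
... | tri> _ _ y<x = subst (λ o → Holds o x y) (sym (ord-> y<x)) y<x

holds⇒ord : ∀ {o x y} → Holds o x y → ord x y ≡ o
holds⇒ord {LT} x<y = ord-< x<y
holds⇒ord {EQ} {x} refl = ord-refl x
holds⇒ord {GT} y<x = ord-> y<x

_≟ʳ_ : DecidableEquality Rel3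
LT ≟ʳ LT = yes refl
EQ ≟ʳ EQ = yes refl
GT ≟ʳ GT = yes refl
LT ≟ʳ EQ = no λ ()
LT ≟ʳ GT = no λ ()
EQ ≟ʳ LT = no λ ()
EQ ≟ʳ GT = no λ ()
GT ≟ʳ LT = no λ ()
GT ≟ʳ EQ = no λ ()

-- Factor occurrences below a bound

record OrderIso {r : ℕ} (p : Fin r → ℕ) (u : List ℕ) : Set where
  constructor orderIso
  field
    length-≡ : length u ≡ r
    ord-≡ : ∀ i j → ord (p i) (p j) ≡ ord (at u (toℕ i)) (at u (toℕ j))

record Occurs {r : ℕ} (p : Fin r → ℕ) (v : ℕ) (w : List ℕ) : Set where
  constructor occurs
  field
    prefix factor suffix : List ℕ
    factorisation : w ≡ prefix ++ factor ++ suffix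
    order-iso : OrderIso p factor
    below : All (_< v) factor

record ShuffleOcc {r₀ r₁ : ℕ} (p₀ : Fin r₀ → ℕ) (p₁ : Fin r₁ → ℕ) (w : List ℕ) : Set where
  constructor shuffleOcc
  field
    before : List ℕ
    peak : ℕ
    after : List ℕ
    factorisation : w ≡ before ++ peak ∷ after
    occurs-before : Occurs p₀ peak before
    occurs-after : Occurs p₁ peak after

module _ {r : ℕ} {p : Fin r → ℕ} where

  occurs-mono : ∀ {v v' w} → v ≤ v' → Occurs p v w → Occurs p v' w
  occurs-mono v≤v' (occurs α u β eq iso below) = occurs α u β eq iso (All.map (λ h → ℕ.<-≤-trans h v≤v') below)

  occurs-++⁺ˡ : ∀ {v} xs ys → Occurs p v xs → Occurs p v (xs ++ ys)
  occurs-++⁺ˡ xs ys (occurs α u β refl iso below) =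
    occurs α u (β ++ ys) (trans (++-assoc α (u ++ β) ys) (cong (α ++_) (++-assoc u β ys))) iso below

  occurs-++⁺ʳ : ∀ {v} xs ys → Occurs p v ys → Occurs p v (xs ++ ys)
  occurs-++⁺ʳ xs ys (occurs α u β refl iso below) = occurs (xs ++ α) u β (sym (++-assoc xs α (u ++ β))) iso below

  occurs-++-∷⁻ : ∀ {v} xs y ys → ¬ y < v → Occurs p v (xs ++ y ∷ ys) → Occurs p v xs ⊎ Occurs p v ys
  occurs-++-∷⁻ xs y ys y≮v (occurs α u β eq iso below) with ++-locate-∷ α (u ++ β) xs y ys (sym eq)
  ... | inj₂ (γ , _ , ys≡) = inj₂ (occurs γ u β ys≡ iso below)
  ... | inj₁ (γ , xs≡ , uβ≡) with ++-locate-∷ u β γ y ys uβ≡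
  ...   | inj₁ (δ , γ≡ , _) = inj₁ (occurs α u δ (trans xs≡ (cong (α ++_) γ≡)) iso below)
  ...   | inj₂ (δ , refl , _) = ⊥-elim (y≮v (All.head (All.++⁻ʳ γ below)))

module _ {r₀ r₁ : ℕ} {p₀ : Fin r₀ → ℕ} {p₁ : Fin r₁ → ℕ} where

  shuffle⇒occurs : ∀ {v} w → All (_≤ v) w → ShuffleOcc p₀ p₁ w → Occurs p₀ v w × Occurs p₁ v w
  shuffle⇒occurs {v} w w≤v (shuffleOcc α x γ refl o₀ o₁) =
      occurs-++⁺ˡ α (x ∷ γ) (occurs-mono x≤v o₀)
    , occurs-++⁺ʳ α (x ∷ γ) (occurs-++⁺ʳ (x ∷ []) γ (occurs-mono x≤v o₁))
    where
    x≤v : x ≤ v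
    x≤v = All.head (All.++⁻ʳ α w≤v)

  shuffle-++-∷ : ∀ {K} β w → All (_< K) β → All (_≤ K) w →
    ShuffleOcc p₀ p₁ (β ++ K ∷ w) ⇔
    (ShuffleOcc p₀ p₁ β ⊎ ShuffleOcc p₀ p₁ w ⊎ (Occurs p₀ K β × Occurs p₁ K w))
  shuffle-++-∷ {K} β w β<K w≤K = mk⇔ decompose recompose
    where
    Cases : Set
    Cases = ShuffleOcc p₀ p₁ β ⊎ ShuffleOcc p₀ p₁ w ⊎ (Occurs p₀ K β × Occurs p₁ K w)

    decompose : ShuffleOcc p₀ p₁ (β ++ K ∷ w) → Cases
    decompose (shuffleOcc α x γ eq o₀ o₁) with ++-locate-∷ α (x ∷ γ) β K w (sym eq)
    ... | inj₁ ([] , β≡ , refl) = inj₂ (inj₂ (subst (Occurs p₀ K) (sym (trans β≡ (++-identityʳ α))) o₀ , o₁))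
    ... | inj₁ (_ ∷ μ , refl , refl) =
      let x≤K = ℕ.<⇒≤ (All.head (All.++⁻ʳ α β<K)) in
      [ (λ o → inj₁ (shuffleOcc α x μ refl o₀ o))
      , (λ o → inj₂ (inj₂ (occurs-++⁺ˡ α (x ∷ μ) (occurs-mono x≤K o₀) , occurs-mono x≤K o))) ]
      (occurs-++-∷⁻ μ K w (ℕ.≤⇒≯ x≤K) o₁)
    ... | inj₂ (μ , refl , refl) =
      let x≤K = All.head (All.++⁻ʳ μ w≤K) in
      [ (λ o → inj₂ (inj₂ ( occurs-mono x≤K o
                          , occurs-++⁺ʳ μ (x ∷ γ) (occurs-++⁺ʳ (x ∷ []) γ (occurs-mono x≤K o₁)))))
      , (λ o → inj₂ (inj₁ (shuffleOcc μ x γ refl o o₁))) ]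
      (occurs-++-∷⁻ β K μ (ℕ.≤⇒≯ x≤K) o₀)

    recompose : Cases → ShuffleOcc p₀ p₁ (β ++ K ∷ w)
    recompose (inj₁ (shuffleOcc α x γ refl o₀ o₁)) =
      shuffleOcc α x (γ ++ K ∷ w) (++-assoc α (x ∷ γ) (K ∷ w)) o₀ (occurs-++⁺ˡ γ (K ∷ w) o₁)
    recompose (inj₂ (inj₁ (shuffleOcc α x γ refl o₀ o₁))) =
      shuffleOcc (β ++ K ∷ α) x γ (sym (++-assoc β (K ∷ α) (x ∷ γ)))
                 (occurs-++⁺ʳ β (K ∷ α) (occurs-++⁺ʳ (K ∷ []) α o₀)) o₁
    recompose (inj₂ (inj₂ (o₀ , o₁))) = shuffleOcc β K w refl o₀ o₁

  shuffle-++-∷-hit : ∀ {K} β w → All (_< K) β → All (_≤ K) w → Occurs p₀ K β →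
    ShuffleOcc p₀ p₁ (β ++ K ∷ w) ⇔ (ShuffleOcc p₀ p₁ β ⊎ Occurs p₁ K w)
  shuffle-++-∷-hit β w β<K w≤K o₀ = mk⇔
    (λ c → case Equivalence.to (shuffle-++-∷ β w β<K w≤K) c of λ
      { (inj₁ c) → inj₁ c
      ; (inj₂ (inj₁ c)) → inj₂ (proj₂ (shuffle⇒occurs w w≤K c))
      ; (inj₂ (inj₂ (_ , o₁))) → inj₂ o₁ })
    (λ { (inj₁ c) → Equivalence.from (shuffle-++-∷ β w β<K w≤K) (inj₁ c)
       ; (inj₂ o₁) → Equivalence.from (shuffle-++-∷ β w β<K w≤K) (inj₂ (inj₂ (o₀ , o₁))) })

  shuffle-++-∷-miss : ∀ {K} β w → All (_< K) β → All (_≤ K) w → ¬ Occurs p₀ K β →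
    ShuffleOcc p₀ p₁ (β ++ K ∷ w) ⇔ ShuffleOcc p₀ p₁ w
  shuffle-++-∷-miss β w β<K w≤K ¬o₀ = mk⇔
    (λ c → case Equivalence.to (shuffle-++-∷ β w β<K w≤K) c of λ
      { (inj₁ c) → ⊥-elim (¬o₀ (proj₁ (shuffle⇒occurs β (All.map ℕ.<⇒≤ β<K) c)))
      ; (inj₂ (inj₁ c)) → c
      ; (inj₂ (inj₂ (o₀ , _))) → ⊥-elim (¬o₀ o₀) })
    (λ c → Equivalence.from (shuffle-++-∷ β w β<K w≤K) (inj₂ (inj₁ c)))

∃-++? : {A : Set} {Q : List A → List A → Set} → (∀ α β → Dec (Q α β)) →
        ∀ w → Dec (∃₂ λ α β → w ≡ α ++ β × Q α β)
∃-++? Q? [] = map′ (λ q → [] , [] , refl , q) (λ { ([] , [] , refl , q) → q }) (Q? [] [])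
∃-++? Q? (c ∷ w) with Q? [] (c ∷ w) | ∃-++? (λ α β → Q? (c ∷ α) β) w
... | yes q | _ = yes ([] , c ∷ w , refl , q)
... | no _ | yes (α , β , refl , q) = yes (c ∷ α , β , refl , q)
... | no ¬q | no ¬r = no λ { ([] , _ , refl , q) → ¬q q ; (_ ∷ α , β , refl , q) → ¬r (α , β , refl , q) }

orderIso? : ∀ {r} (p : Fin r → ℕ) u → Dec (OrderIso p u)
orderIso? {r} p u = map′ (λ (l , o) → orderIso l o) (λ (orderIso l o) → l , o)
  (length u ℕ.≟ r ×-dec all? λ i → all? λ j → ord (p i) (p j) ≟ʳ ord (at u (toℕ i)) (at u (toℕ j)))

occurs? : ∀ {r} (p : Fin r → ℕ) v w → Dec (Occurs p v w)
occurs? p v w = map′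
  (λ { (α , _ , refl , u , β , refl , iso , below) → occurs α u β refl iso below })
  (λ { (occurs α u β refl iso below) → α , u ++ β , refl , u , β , refl , iso , below })
  (∃-++? (λ _ → ∃-++? (λ u _ → orderIso? p u ×-dec All.all? (_<? v) u)) w)

shuffleOcc? : ∀ {r₀ r₁} (p₀ : Fin r₀ → ℕ) (p₁ : Fin r₁ → ℕ) w → Dec (ShuffleOcc p₀ p₁ w)
shuffleOcc? p₀ p₁ w = map′
  (λ { (α , x ∷ γ , refl , o₀ , o₁) → shuffleOcc α x γ refl o₀ o₁ })
  (λ { (shuffleOcc α x γ refl o₀ o₁) → α , x ∷ γ , refl , o₀ , o₁ })
  (∃-++? peak? w)
  where
  Peak : List ℕ → List ℕ → Set
  Peak α [] = ⊥
  Peak α (x ∷ γ) = Occurs p₀ x α × Occurs p₁ x γ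
  peak? : ∀ α β → Dec (Peak α β)
  peak? α [] = no λ ()
  peak? α (x ∷ γ) = occurs? p₀ x α ×-dec occurs? p₁ x γ

-- Reversal and complement

module _ {r : ℕ} where

  orderIso-cong : ∀ {p p' : Fin r → ℕ} {u} → (∀ i → p i ≡ p' i) → OrderIso p u → OrderIso p' u
  orderIso-cong p≗p' (orderIso len iso) = orderIso len λ i j → trans (sym (cong₂ ord (p≗p' i) (p≗p' j))) (iso i j)

  occurs-cong : ∀ {p p' : Fin r → ℕ} {v w} → (∀ i → p i ≡ p' i) → Occurs p v w → Occurs p' v w
  occurs-cong p≗p' (occurs α u β eq iso below) = occurs α u β eq (orderIso-cong p≗p' iso) below

  orderIso-reverse : ∀ {p : Fin r → ℕ} {u} → OrderIso p u → OrderIso (p ∘ opposite) (reverse u)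
  orderIso-reverse {p} {u} (orderIso refl iso) = orderIso (length-reverse u) λ i j →
    trans (iso (opposite i) (opposite j)) (sym (cong₂ ord (at-rev i) (at-rev j)))
    where
    at-rev : ∀ i → at (reverse u) (toℕ i) ≡ at u (toℕ (opposite i))
    at-rev i = trans (at-reverse u (toℕ<n i)) (cong (at u) (sym (opposite-prop i)))

  occurs-reverse : ∀ {p : Fin r → ℕ} {v w} → Occurs p v w → Occurs (p ∘ opposite) v (reverse w)
  occurs-reverse (occurs α u β refl iso below) =
    occurs (reverse β) (reverse u) (reverse α) reverse-split (orderIso-reverse iso) (All-reverse below)
    where
    reverse-split : reverse (α ++ u ++ β) ≡ reverse β ++ reverse u ++ reverse α
    reverse-split = begin
      reverse (α ++ u ++ β)                  ≡⟨ reverse-++ α (u ++ β) ⟩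
      reverse (u ++ β) ++ reverse α          ≡⟨ cong (_++ reverse α) (reverse-++ u β) ⟩
      (reverse β ++ reverse u) ++ reverse α  ≡⟨ ++-assoc (reverse β) (reverse u) (reverse α) ⟩
      reverse β ++ reverse u ++ reverse α    ∎
      where open ≡-Reasoning

  occurs-reverse-⇔ : ∀ {p : Fin r → ℕ} {v w} → Occurs p v w ⇔ Occurs (p ∘ opposite) v (reverse w)
  occurs-reverse-⇔ {p} {v} {w} = mk⇔ occurs-reverse λ o →
    subst (Occurs p v) (reverse-involutive w) (occurs-cong (cong p ∘ opposite-involutive) (occurs-reverse o))

  orderIso-complement : ∀ {p : Fin r → ℕ} {m v u} → (∀ i → p i < m) → All (_< v) u → OrderIso p u →
    OrderIso (λ i → m ∸ suc (p i)) (map (λ c → v ∸ suc c) u)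
  orderIso-complement {p} {m} {v} {u} p<m u<v (orderIso refl iso) = orderIso (length-map _ u) λ i j → begin
    ord (m ∸ suc (p i)) (m ∸ suc (p j))                    ≡⟨ ord-∸ (p<m i) (p<m j) ⟩
    ord (p j) (p i)                                        ≡⟨ iso j i ⟩
    ord (at u (toℕ j)) (at u (toℕ i))                      ≡⟨ ord-∸ (All-at u<v (toℕ<n i)) (All-at u<v (toℕ<n j)) ⟨
    ord (v ∸ suc (at u (toℕ i))) (v ∸ suc (at u (toℕ j)))  ≡⟨ cong₂ ord (at-map _ u (toℕ<n i)) (at-map _ u (toℕ<n j)) ⟨
    ord (at (map (λ c → v ∸ suc c) u) (toℕ i)) (at (map (λ c → v ∸ suc c) u) (toℕ j)) ∎
    where open ≡-Reasoning

  occurs-complement : ∀ {p : Fin r → ℕ} {m v w} → (∀ i → p i < m) →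
    Occurs p v w → Occurs (λ i → m ∸ suc (p i)) v (map (λ c → v ∸ suc c) w)
  occurs-complement {v = v} p<m (occurs α u β refl iso below) =
    occurs (map flip α) (map flip u) (map flip β) complement-split (orderIso-complement p<m below iso)
           (All.map⁺ (All.map (ℕ.∸-monoʳ-< (s≤s z≤n)) below))
    where
    flip : ℕ → ℕ
    flip c = v ∸ suc c
    complement-split : map flip (α ++ u ++ β) ≡ map flip α ++ map flip u ++ map flip β
    complement-split = trans (map-++ flip α (u ++ β)) (cong (map flip α ++_) (map-++ flip u β))

shuffleOcc-cong : ∀ {r₀ r₁} {p₀ q₀ : Fin r₀ → ℕ} {p₁ q₁ : Fin r₁ → ℕ} {w} →
                  (∀ i → p₀ i ≡ q₀ i) → (∀ i → p₁ i ≡ q₁ i) → ShuffleOcc p₀ p₁ w → ShuffleOcc q₀ q₁ w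
shuffleOcc-cong p₀≗q₀ p₁≗q₁ (shuffleOcc α x β eq o₀ o₁) =
  shuffleOcc α x β eq (occurs-cong p₀≗q₀ o₀) (occurs-cong p₁≗q₁ o₁)

shuffleOcc-reverse : ∀ {r₀ r₁} {p₀ : Fin r₀ → ℕ} {p₁ : Fin r₁ → ℕ} {w} →
                     ShuffleOcc p₀ p₁ w → ShuffleOcc (p₁ ∘ opposite) (p₀ ∘ opposite) (reverse w)
shuffleOcc-reverse (shuffleOcc α x β refl o₀ o₁) =
  shuffleOcc (reverse β) x (reverse α) reverse-split (occurs-reverse o₁) (occurs-reverse o₀)
  where
  reverse-split : reverse (α ++ x ∷ β) ≡ reverse β ++ x ∷ reverse α
  reverse-split = begin
    reverse (α ++ x ∷ β)                ≡⟨ reverse-++ α (x ∷ β) ⟩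
    reverse (x ∷ β) ++ reverse α        ≡⟨ cong (_++ reverse α) (unfold-reverse x β) ⟩
    (reverse β ++ x ∷ []) ++ reverse α  ≡⟨ ++-assoc (reverse β) (x ∷ []) (reverse α) ⟩
    reverse β ++ x ∷ reverse α          ∎
    where open ≡-Reasoning

shuffleOcc-reverse-⇔ : ∀ {r₀ r₁} {p₀ : Fin r₀ → ℕ} {p₁ : Fin r₁ → ℕ} {w} →
                       ShuffleOcc p₀ p₁ w ⇔ ShuffleOcc (p₁ ∘ opposite) (p₀ ∘ opposite) (reverse w)
shuffleOcc-reverse-⇔ {p₀ = p₀} {p₁} {w} = mk⇔ shuffleOcc-reverse λ c →
  subst (ShuffleOcc p₀ p₁) (reverse-involutive w)
    (shuffleOcc-cong (cong p₀ ∘ opposite-involutive) (cong p₁ ∘ opposite-involutive) (shuffleOcc-reverse c))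

-- Length-preserving bijections of words

↓ : ∀ {k} → List (Fin k) → List ℕ
↓ = map toℕ

↓-< : ∀ {k} (w : List (Fin k)) → All (_< k) (↓ w)
↓-< w = All.map⁺ (All.universal toℕ<n w)

↓-≤ : ∀ {K} (w : List (Fin (suc K))) → All (_≤ K) (↓ w)
↓-≤ w = All.map⁺ (All.universal toℕ≤pred[n] w)

pat : ∀ {r m} → (Fin r → Fin m) → Fin r → ℕ
pat τ = toℕ ∘ τ

record WordBij (k : ℕ) (A B : List ℕ → Set) : Set where
  field
    bij : List (Fin k) ↔ List (Fin k)
    length-pres : ∀ w → length (to bij w) ≡ length w
    transport : ∀ w → A (↓ w) ⇔ B (↓ (to bij w))

open WordBij public

module _ {k : ℕ} where

  wordBij-refl : ∀ {A} → WordBij k A A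
  wordBij-refl = record { bij = ↔-refl ; length-pres = λ _ → refl ; transport = λ _ → ⇔-id _ }

  wordBij-trans : ∀ {A B C} → WordBij k A B → WordBij k B C → WordBij k A C
  wordBij-trans F G = record
    { bij = ↔-trans (bij F) (bij G)
    ; length-pres = λ w → trans (length-pres G (to (bij F) w)) (length-pres F w)
    ; transport = λ w → transport G (to (bij F) w) ⇔-∘ transport F w
    }

  wordBij-sym : ∀ {A B} → WordBij k A B → WordBij k B A
  wordBij-sym {A} {B} F = record
    { bij = ↔-sym (bij F)
    ; length-pres = λ w → trans (sym (length-pres F (from (bij F) w))) (cong length (strictlyInverseˡ (bij F) w))
    ; transport = λ w → ⇔-sym (subst (λ u → A (↓ (from (bij F) w)) ⇔ B (↓ u)) (strictlyInverseˡ (bij F) w)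
                                     (transport F (from (bij F) w)))
    }

  wordBij-involution : ∀ {A B} (f : List (Fin k) → List (Fin k)) → (∀ w → f (f w) ≡ w) →
    (∀ w → length (f w) ≡ length w) → (∀ w → A (↓ w) ⇔ B (↓ (f w))) → WordBij k A B
  wordBij-involution f f∘f length-f A⇔B = record
    { bij = mk↔ₛ′ f f f∘f f∘f ; length-pres = length-f ; transport = A⇔B }

  wordBij-reverse : ∀ {A B} → (∀ u → A u ⇔ B (reverse u)) → WordBij k A B
  wordBij-reverse {A} {B} A⇔B = wordBij-involution reverse reverse-involutive length-reverse
    λ w → subst (λ u → A (↓ w) ⇔ B u) (sym (reverse-map toℕ w)) (A⇔B (↓ w))

  wordBij-reverse⁻ : ∀ {A B} → (∀ u → B u ⇔ A (reverse u)) → WordBij k A B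
  wordBij-reverse⁻ {A} {B} B⇔A = wordBij-reverse λ u →
    ⇔-sym (subst (λ u' → B (reverse u) ⇔ A u') (reverse-involutive u) (B⇔A (reverse u)))

module _ {r m k : ℕ} where

  ↓-opposite : (w : List (Fin k)) → ↓ (map opposite w) ≡ map (λ c → k ∸ suc c) (↓ w)
  ↓-opposite w = trans (sym (map-∘ w)) (trans (map-cong opposite-prop w) (map-∘ w))

  map-opposite-involutive : (w : List (Fin k)) → map opposite (map opposite w) ≡ w
  map-opposite-involutive w = trans (sym (map-∘ w)) (trans (map-cong opposite-involutive w) (map-id w))

  occurs-opposite : (τ : Fin r → Fin m) (w : List (Fin k)) →
    Occurs (pat τ) k (↓ w) → Occurs (pat (opposite ∘ τ)) k (↓ (map opposite w))
  occurs-opposite τ w o = occurs-cong (λ i → sym (opposite-prop (τ i)))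
    (subst (Occurs _ k) (sym (↓-opposite w)) (occurs-complement (λ i → toℕ<n (τ i)) o))

  occurs-opposite-⇔ : (τ : Fin r → Fin m) (w : List (Fin k)) →
    Occurs (pat τ) k (↓ w) ⇔ Occurs (pat (opposite ∘ τ)) k (↓ (map opposite w))
  occurs-opposite-⇔ τ w = mk⇔ (occurs-opposite τ w) λ o →
    subst (Occurs (pat τ) k ∘ ↓) (map-opposite-involutive w)
      (occurs-cong (cong toℕ ∘ opposite-involutive ∘ τ) (occurs-opposite (opposite ∘ τ) (map opposite w) o))

  complementBij : (τ : Fin r → Fin m) → WordBij k (Occurs (pat τ) k) (Occurs (pat (opposite ∘ τ)) k)
  complementBij τ = wordBij-involution (map opposite) map-opposite-involutive (length-map opposite) (occurs-opposite-⇔ τ)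

  trivialBij : (t : TrivBij) (τ : Fin r → Fin m) → WordBij k (Occurs (pat τ) k) (Occurs (pat (applyTB t τ)) k)
  trivialBij idB τ = wordBij-refl
  trivialBij revB τ = wordBij-reverse λ _ → occurs-reverse-⇔
  trivialBij compB τ = complementBij τ
  trivialBij revcompB τ = wordBij-trans (complementBij τ) (wordBij-reverse λ _ → occurs-reverse-⇔)

-- Counting

Fibre : {X C : Set} → (X → C) → C → Set
Fibre {X} c i = Σ[ x ∈ X ] c x ≡ i

fibration : {X C : Set} (c : X → C) → X ↔ Σ C (Fibre c)
fibration c = mk↔ₛ′ (λ x → c x , x , refl) (λ (_ , x , _) → x) (λ { (_ , _ , refl) → refl }) (λ _ → refl)

recolour : {X C : Set} (c c' : X → C) → (∀ i → Fibre c i ↔ Fibre c' i) →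
           Σ[ H ∈ X ↔ X ] ∀ x → c' (to H x) ≡ c x
recolour c c' c↔c' = ↔-trans (fibration c) (↔-trans (Σ-↔ ↔-refl (c↔c' _)) (↔-sym (fibration c'))) ,
                     λ x → proj₂ (to (c↔c' (c x)) (x , refl))

module _ {C : Set} (_≟_ : DecidableEquality C) where

  fibre-≡ : {X : Set} {c : X → C} {i : C} {x y : X} {p : c x ≡ i} {q : c y ≡ i} →
            x ≡ y → _≡_ {A = Fibre c i} (x , p) (y , q)
  fibre-≡ {p = p} {q} refl = cong (_ ,_) (Decidable⇒UIP.≡-irrelevant _≟_ p q)

  fibre-↔ : {X Y : Set} {c : X → C} {c' : Y → C} {i : C} (e : X ↔ Y) →
            (∀ x → c x ≡ i → c' (to e x) ≡ i) → (∀ y → c' y ≡ i → c (from e y) ≡ i) →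
            Fibre c i ↔ Fibre c' i
  fibre-↔ e to-i from-i = mk↔ₛ′ (λ (x , p) → to e x , to-i x p) (λ (y , q) → from e y , from-i y q)
    (λ (y , _) → fibre-≡ (strictlyInverseˡ e y)) (λ (x , _) → fibre-≡ (strictlyInverseʳ e x))

fibre-pair : {X L J : Set} (ℓ : X → L) (κ : X → J) (n : L) →
             Fibre ℓ n ↔ Σ J (λ j → Fibre (λ x → ℓ x , κ x) (n , j))
fibre-pair ℓ κ n = mk↔ₛ′ (λ (x , p) → κ x , x , cong (_, κ x) p) (λ (_ , x , q) → x , cong proj₁ q)
                         (λ { (_ , _ , refl) → refl }) (λ { (_ , refl) → refl })

Σ-Bool² : {Φ : Bool × Bool → Set} →
          Σ (Bool × Bool) Φ ↔ (Φ (true , false) ⊎ Φ (true , true) ⊎ Φ (false , true) ⊎ Φ (false , false))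
Σ-Bool² = mk↔ₛ′
  (λ { ((true , false) , x) → inj₁ x ; ((true , true) , x) → inj₂ (inj₁ x)
     ; ((false , true) , x) → inj₂ (inj₂ (inj₁ x)) ; ((false , false) , x) → inj₂ (inj₂ (inj₂ x)) })
  (λ { (inj₁ x) → _ , x ; (inj₂ (inj₁ x)) → _ , x ; (inj₂ (inj₂ (inj₁ x))) → _ , x ; (inj₂ (inj₂ (inj₂ x))) → _ , x })
  (λ { (inj₁ _) → refl ; (inj₂ (inj₁ _)) → refl ; (inj₂ (inj₂ (inj₁ _))) → refl ; (inj₂ (inj₂ (inj₂ _))) → refl })
  (λ { ((true , false) , _) → refl ; ((true , true) , _) → refl ; ((false , true) , _) → refl ; ((false , false) , _) → refl })

Finite : Set → Set
Finite A = ∃[ m ] A ↔ Fin m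

Σ-Fin-suc : ∀ {N} {P : Fin (suc N) → Set} → Σ (Fin (suc N)) P ↔ (P zero ⊎ Σ (Fin N) (λ i → P (suc i)))
Σ-Fin-suc = mk↔ₛ′ (λ { (zero , p) → inj₁ p ; (suc i , p) → inj₂ (i , p) })
                  (λ { (inj₁ p) → zero , p ; (inj₂ (i , p)) → suc i , p })
                  (λ { (inj₁ _) → refl ; (inj₂ _) → refl })
                  (λ { (zero , _) → refl ; (suc _ , _) → refl })

Σ-Fin-finite : ∀ {N} {P : Fin N → Set} → (∀ i → Finite (P i)) → Finite (Σ (Fin N) P)
Σ-Fin-finite {zero} _ = 0 , mk↔ₛ′ (λ ()) (λ ()) (λ ()) (λ ())
Σ-Fin-finite {suc N} fin with fin zero | Σ-Fin-finite (λ i → fin (suc i))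
... | a , P₀↔a | b , rest↔b = a + b , ↔-trans Σ-Fin-suc (↔-trans (P₀↔a ⊎-↔ rest↔b) (↔-sym +↔⊎))

inj₁-fibre-finite : {A B : Set} (s : A ⊎ B) → Finite (Fibre (inj₁ {B = B}) s)
inj₁-fibre-finite (inj₁ a) = 1 , mk↔ₛ′ (λ _ → zero) (λ _ → a , refl) (λ { zero → refl }) (λ { (_ , refl) → refl })
inj₁-fibre-finite (inj₂ b) = 0 , mk↔ₛ′ (λ { (_ , ()) }) (λ ()) (λ ()) (λ { (_ , ()) })

summand-finite : ∀ {A B : Set} {N} → (A ⊎ B) ↔ Fin N → Finite A
summand-finite e with Σ-Fin-finite (λ j → inj₁-fibre-finite (from e j))
... | m , fibres↔m = m , ↔-trans (fibration inj₁) (↔-trans (↔-sym (Σ-↔ (↔-sym e) ↔-refl)) fibres↔m)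

↔-Fin-injective : ∀ {m n} → Fin m ↔ Fin n → m ≡ n
↔-Fin-injective e = cantor-schröder-bernstein (Injection.injective (↔⇒↣ e)) (Injection.injective (↔⇒↣ (↔-sym e)))

⊎-cancelʳ-finite : ∀ {A B A' B' : Set} {N} → (A ⊎ B) ↔ Fin N → (A' ⊎ B') ↔ Fin N → B ↔ B' → A ↔ A'
⊎-cancelʳ-finite {A} {B} {A'} {B'} {N} e e' B↔B'
  with summand-finite e | summand-finite (↔-trans (⊎-comm B A) e)
     | summand-finite e' | summand-finite (↔-trans (⊎-comm B' A') e')
... | a , A↔a | b , B↔b | a' , A'↔a' | b' , B'↔b' =
  ↔-trans A↔a (subst (λ m → Fin m ↔ A') (sym a≡a') (↔-sym A'↔a'))
  where
  size : ∀ {C D c d} → (C ⊎ D) ↔ Fin N → C ↔ Fin c → D ↔ Fin d → c + d ≡ N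
  size e C↔c D↔d = ↔-Fin-injective (↔-trans +↔⊎ (↔-trans (↔-sym C↔c ⊎-↔ ↔-sym D↔d) e))
  b≡b' : b ≡ b'
  b≡b' = ↔-Fin-injective (↔-trans (↔-sym B↔b) (↔-trans B↔B' B'↔b'))
  a≡a' : a ≡ a'
  a≡a' = ℕ.+-cancelʳ-≡ b a a'
    (trans (size e A↔a B↔b) (sym (subst (λ d → a' + d ≡ N) (sym b≡b') (size e' A'↔a' B'↔b'))))

module _ {A : Set} where

  toList-cast : ∀ {m n} (eq : m ≡ n) (v : Vec A m) → toList (cast eq v) ≡ toList v
  toList-cast refl v = cong toList (cast-is-id refl v)

  Vec↔List : ∀ {n} → Vec A n ↔ Fibre (length {A = A}) n
  Vec↔List = mk↔ₛ′ (λ v → toList v , length-toList v) (λ (w , eq) → cast eq (fromList w))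
    (λ (w , eq) → Σ-≡ (trans (toList-cast eq (fromList w)) (toList∘fromList w)))
    fromList∘toList
    where
    Σ-≡ : ∀ {n} {w w' : List A} {e : length w ≡ n} {e' : length w' ≡ n} → w ≡ w' →
          _≡_ {A = Fibre length n} (w , e) (w' , e')
    Σ-≡ {e = e} {e'} refl = cong (_ ,_) (ℕ.≡-irrelevant e e')

length-fibre-finite : ∀ {K} n → Finite (Fibre (length {A = Fin K}) n)
length-fibre-finite {K} n = K ^ n ,
  ↔-trans (↔-sym Vec↔List)
    (↔-trans (mk↔ₛ′ fromVec (toVec n) (fromVec∘toVec n) toVec∘fromVec) (↔-sym (Fin[m^n]↔Fin[m]^n K n)))

dec-true⁻¹ : {P : Set} (p? : Dec P) → does p? ≡ true → P
dec-true⁻¹ (yes p) _ = p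

dec-false⁻¹ : {P : Set} (p? : Dec P) → does p? ≡ false → ¬ P
dec-false⁻¹ (no ¬p) _ = ¬p

does-≡⇒⇔ : ∀ {P Q : Set} (p? : Dec P) (q? : Dec Q) → does q? ≡ does p? → P ⇔ Q
does-≡⇒⇔ (yes p) (yes q) _ = mk⇔ (λ _ → q) (λ _ → p)
does-≡⇒⇔ (no ¬p) (no ¬q) _ = mk⇔ (⊥-elim ∘ ¬p) (⊥-elim ∘ ¬q)
does-≡⇒⇔ (yes _) (no _) ()
does-≡⇒⇔ (no _) (yes _) ()

module _ {X : Set} (ℓ : X → ℕ) (ℓ-finite : ∀ n → Finite (Fibre ℓ n))
         {A B A' B' : X → Set} (A? : Decidable A) (B? : Decidable B) (A'? : Decidable A') (B'? : Decidable B')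
         (B⊆A : ∀ {x} → B x → A x) (B'⊆A' : ∀ {x} → B' x → A' x) where

  private
    colourBy : (X → Bool × Bool) → X → ℕ × Bool × Bool
    colourBy κ x = ℓ x , κ x

    colour colour' : X → ℕ × Bool × Bool
    colour = colourBy λ x → does (A? x) , does (B? x)
    colour' = colourBy λ x → does (A'? x) , does (B'? x)

    _≟ᶜ_ : DecidableEquality (ℕ × Bool × Bool)
    _≟ᶜ_ = ≡-dec ℕ._≟_ (≡-dec Bool._≟_ Bool._≟_)

  module _ (F : X ↔ X) (ℓF : ∀ x → ℓ (to F x) ≡ ℓ x) (AF : ∀ x → A x ⇔ A' (to F x))
           (G : X ↔ X) (ℓG : ∀ x → ℓ (to G x) ≡ ℓ x) (BG : ∀ x → B x ⇔ B' (to G x)) where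

    private
      -- outside A, F already preserves the colour; inside B, G does
      F-colour : ∀ x → ¬ A x → colour' (to F x) ≡ colour x
      F-colour x ¬a = cong₂ _,_ (ℓF x) (cong₂ _,_
        (trans (dec-false (A'? (to F x)) (¬a ∘ Equivalence.from (AF x))) (sym (dec-false (A? x) ¬a)))
        (trans (dec-false (B'? (to F x)) (¬a ∘ Equivalence.from (AF x) ∘ B'⊆A')) (sym (dec-false (B? x) (¬a ∘ B⊆A)))))

      G-colour : ∀ x → B x → colour' (to G x) ≡ colour x
      G-colour x b = cong₂ _,_ (ℓG x) (cong₂ _,_
        (trans (dec-true (A'? (to G x)) (B'⊆A' (Equivalence.to (BG x) b))) (sym (dec-true (A? x) (B⊆A b))))
        (trans (dec-true (B'? (to G x)) (Equivalence.to (BG x) b)) (sym (dec-true (B? x) b))))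

      transport-fibre : (E : X ↔ X) {S : X → Set} → (∀ x → S x → colour' (to E x) ≡ colour x) →
                        ∀ {i} → (∀ x → colour x ≡ i → S x) → (∀ y → colour' y ≡ i → S (from E y)) →
                        Fibre colour i ↔ Fibre colour' i
      transport-fibre E pres inS inS' = fibre-↔ _≟ᶜ_ E (λ x p → trans (pres x (inS x p)) p)
        (λ y q → trans (sym (pres (from E y) (inS' y q))) (trans (cong colour' (strictlyInverseˡ E y)) q))

      in-B : ∀ {n a} → Fibre colour (n , a , true) ↔ Fibre colour' (n , a , true)
      in-B = transport-fibre G G-colour (λ x p → dec-true⁻¹ (B? x) (cong (proj₂ ∘ proj₂) p))
        (λ y q → Equivalence.from (BG _)
                   (subst B' (sym (strictlyInverseˡ G y)) (dec-true⁻¹ (B'? y) (cong (proj₂ ∘ proj₂) q))))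

      outside-A : ∀ {n} → Fibre colour (n , false , false) ↔ Fibre colour' (n , false , false)
      outside-A = transport-fibre F F-colour (λ x p → dec-false⁻¹ (A? x) (cong (proj₁ ∘ proj₂) p))
        (λ y q a → dec-false⁻¹ (A'? y) (cong (proj₁ ∘ proj₂) q)
                     (subst A' (strictlyInverseˡ F y) (Equivalence.to (AF _) a)))

      split-length : ∀ κ n → (Fibre (colourBy κ) (n , true , false) ⊎ Fibre (colourBy κ) (n , true , true) ⊎
                              Fibre (colourBy κ) (n , false , true) ⊎ Fibre (colourBy κ) (n , false , false))
                             ↔ Fin (proj₁ (ℓ-finite n))
      split-length κ n = ↔-trans (↔-sym Σ-Bool²) (↔-trans (↔-sym (fibre-pair ℓ κ n)) (proj₂ (ℓ-finite n)))

      -- the remaining class A ∖ B is matched by counting the words of each length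
      fibres : ∀ i → Fibre colour i ↔ Fibre colour' i
      fibres (n , a , true) = in-B
      fibres (n , false , false) = outside-A
      fibres (n , true , false) = ⊎-cancelʳ-finite (split-length _ n) (split-length _ n) (in-B ⊎-↔ in-B ⊎-↔ outside-A)

    harmonise : Σ[ H ∈ X ↔ X ] ∀ x → ℓ (to H x) ≡ ℓ x × (A x ⇔ A' (to H x)) × (B x ⇔ B' (to H x))
    harmonise with recolour colour colour' fibres
    ... | H , H-colour = H , λ x →
        cong proj₁ (H-colour x)
      , does-≡⇒⇔ (A? x) (A'? (to H x)) (cong (proj₁ ∘ proj₂) (H-colour x))
      , does-≡⇒⇔ (B? x) (B'? (to H x)) (cong (proj₂ ∘ proj₂) (H-colour x))

-- Blocks between occurrences of the top letter

module _ {K : ℕ} where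

  lift : List (Fin K) → List (Fin (suc K))
  lift = map inject₁

  joinFrom : List (Fin K) → List (List (Fin K)) → List (Fin (suc K))
  joinFrom β [] = lift β
  joinFrom β (γ ∷ γs) = lift β ++ fromℕ K ∷ joinFrom γ γs

  join : List⁺ (List (Fin K)) → List (Fin (suc K))
  join (β ∷ γs) = joinFrom β γs

  split : List (Fin (suc K)) → List⁺ (List (Fin K))
  split [] = [] ∷ []
  split (c ∷ w) with view c
  ... | ‵fromℕ = [] ∷⁺ split w
  ... | ‵inj₁ {i = i} _ = (i ∷ head (split w)) ∷ tail (split w)

  join-∷ : ∀ i β γs → join ((i ∷ β) ∷ γs) ≡ inject₁ i ∷ join (β ∷ γs)
  join-∷ i β [] = refl
  join-∷ i β (γ ∷ γs) = refl

  join-split : ∀ w → join (split w) ≡ w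
  join-split [] = refl
  join-split (c ∷ w) with view c
  ... | ‵fromℕ = cong (fromℕ K ∷_) (join-split w)
  ... | ‵inj₁ {i = i} _ = trans (join-∷ i (head (split w)) (tail (split w))) (cong (inject₁ i ∷_) (join-split w))

  split-join : ∀ β γs → split (join (β ∷ γs)) ≡ β ∷ γs
  split-join [] [] = refl
  split-join [] (γ ∷ γs) rewrite view-fromℕ K | split-join γ γs = refl
  split-join (i ∷ β) γs rewrite join-∷ i β γs | view-inject₁ i | split-join β γs = refl

  ↓-lift : ∀ β → ↓ (lift β) ≡ ↓ β
  ↓-lift β = trans (sym (map-∘ β)) (map-cong toℕ-inject₁ β)

  ↓-join-∷ : ∀ β γ γs → ↓ (join (β ∷ γ ∷ γs)) ≡ ↓ β ++ K ∷ ↓ (join (γ ∷ γs))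
  ↓-join-∷ β γ γs = trans (map-++ toℕ (lift β) (fromℕ K ∷ join (γ ∷ γs)))
    (cong₂ _++_ (↓-lift β) (cong (_∷ ↓ (join (γ ∷ γs))) (toℕ-fromℕ K)))

  length-join-∷ : ∀ β γ γs → length (join (β ∷ γ ∷ γs)) ≡ length β + suc (length (join (γ ∷ γs)))
  length-join-∷ β γ γs = trans (length-++ (lift β)) (cong (_+ _) (length-map inject₁ β))

module _ {K r₀ r₁ : ℕ} {p₀ : Fin r₀ → ℕ} {p₁ : Fin r₁ → ℕ} (β γ : List (Fin K)) (γs : List (List (Fin K))) where

  shuffle-join-hit : Occurs p₀ K (↓ β) →
    ShuffleOcc p₀ p₁ (↓ (join (β ∷ γ ∷ γs))) ⇔ (ShuffleOcc p₀ p₁ (↓ β) ⊎ Occurs p₁ K (↓ (join (γ ∷ γs))))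
  shuffle-join-hit o =
    subst (λ u → ShuffleOcc p₀ p₁ u ⇔ (ShuffleOcc p₀ p₁ (↓ β) ⊎ Occurs p₁ K (↓ (join (γ ∷ γs)))))
          (sym (↓-join-∷ β γ γs))
      (shuffle-++-∷-hit (↓ β) (↓ (join (γ ∷ γs))) (↓-< β) (↓-≤ (join (γ ∷ γs))) o)

  shuffle-join-miss : ¬ Occurs p₀ K (↓ β) →
    ShuffleOcc p₀ p₁ (↓ (join (β ∷ γ ∷ γs))) ⇔ ShuffleOcc p₀ p₁ (↓ (join (γ ∷ γs)))
  shuffle-join-miss ¬o =
    subst (λ u → ShuffleOcc p₀ p₁ u ⇔ ShuffleOcc p₀ p₁ (↓ (join (γ ∷ γs))))
          (sym (↓-join-∷ β γ γs))
      (shuffle-++-∷-miss (↓ β) (↓ (join (γ ∷ γs))) (↓-< β) (↓-≤ (join (γ ∷ γs))) ¬o)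

module Transform {K : ℕ} {Hit : List (Fin K) → Set} (hit? : Decidable Hit) (F H : List (Fin K) → List (Fin K)) where

  transformFrom : List (Fin K) → List (List (Fin K)) → List⁺ (List (Fin K))
  transformFrom β [] = H β ∷ []
  transformFrom β (γ ∷ γs) = if does (hit? β) then H β ∷ γ ∷ γs else F β ∷⁺ transformFrom γ γs

  transform : List (Fin (suc K)) → List (Fin (suc K))
  transform w = join (transformFrom (head (split w)) (tail (split w)))

  module _ (length-F : ∀ β → length (F β) ≡ length β) (length-H : ∀ β → length (H β) ≡ length β) where

    length-transformFrom : ∀ β γs → length (join (transformFrom β γs)) ≡ length (join (β ∷ γs))
    length-transformFrom β [] = trans (length-map inject₁ (H β)) (trans (length-H β) (sym (length-map inject₁ β)))
    length-transformFrom β (γ ∷ γs) with does (hit? β)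
    ... | true = trans (length-join-∷ (H β) γ γs) (trans (cong (_+ _) (length-H β)) (sym (length-join-∷ β γ γs)))
    ... | false = trans (length-join-∷ (F β) (head (transformFrom γ γs)) (tail (transformFrom γ γs)))
                    (trans (cong₂ (λ m n → m + suc n) (length-F β) (length-transformFrom γ γs))
                           (sym (length-join-∷ β γ γs)))

    length-transform : ∀ w → length (transform w) ≡ length w
    length-transform w = trans (length-transformFrom (head (split w)) (tail (split w))) (cong length (join-split w))

module _ {K : ℕ} {Hit Hit' : List (Fin K) → Set} (hit? : Decidable Hit) (hit'? : Decidable Hit')
         {F H F' H' : List (Fin K) → List (Fin K)}
         (F-hit : ∀ β → Hit β ⇔ Hit' (F β)) (H-hit : ∀ β → Hit β ⇔ Hit' (H β))
         (F'∘F : ∀ β → F' (F β) ≡ β) (H'∘H : ∀ β → H' (H β) ≡ β) where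

  private
    module T = Transform hit? F H
    module T' = Transform hit'? F' H'

  transformFrom-inverse : ∀ β γs →
    T'.transformFrom (head (T.transformFrom β γs)) (tail (T.transformFrom β γs)) ≡ β ∷ γs
  transformFrom-inverse β [] = cong (_∷ []) (H'∘H β)
  transformFrom-inverse β (γ ∷ γs) with hit? β
  ... | yes h rewrite dec-true (hit'? (H β)) (Equivalence.to (H-hit β) h) = cong (_∷ γ ∷ γs) (H'∘H β)
  ... | no ¬h rewrite dec-false (hit'? (F β)) (¬h ∘ Equivalence.from (F-hit β)) =
    cong₂ _∷⁺_ (F'∘F β) (transformFrom-inverse γ γs)

  transform-inverse : ∀ w → T'.transform (T.transform w) ≡ w
  transform-inverse w = begin
    T'.transform (T.transform w)                 ≡⟨ cong (λ bs → join (T'.transformFrom (head bs) (tail bs)))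
                                                         (split-join (head bs) (tail bs)) ⟩
    join (T'.transformFrom (head bs) (tail bs))  ≡⟨ cong join (transformFrom-inverse (head (split w)) (tail (split w))) ⟩
    join (split w)                               ≡⟨ join-split w ⟩
    w                                            ∎
    where
    open ≡-Reasoning
    bs : List⁺ (List (Fin K))
    bs = T.transformFrom (head (split w)) (tail (split w))

module _ {K r₀ r₀' r₁ : ℕ} {P : Fin r₀ → ℕ} {Q : Fin r₀' → ℕ} {p₁ : Fin r₁ → ℕ}
         (hit? : ∀ (β : List (Fin K)) → Dec (Occurs P K (↓ β))) {F H : List (Fin K) → List (Fin K)}
         (F-occ : ∀ β → Occurs P K (↓ β) ⇔ Occurs Q K (↓ (F β)))
         (H-occ : ∀ β → Occurs P K (↓ β) ⇔ Occurs Q K (↓ (H β)))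
         (H-shuffle : ∀ β → ShuffleOcc P p₁ (↓ β) ⇔ ShuffleOcc Q p₁ (↓ (H β))) where

  open Transform hit? F H

  transformFrom-shuffle : ∀ β γs →
    ShuffleOcc P p₁ (↓ (join (β ∷ γs))) ⇔ ShuffleOcc Q p₁ (↓ (join (transformFrom β γs)))
  transformFrom-shuffle β [] =
    subst₂ (λ u u' → ShuffleOcc P p₁ u ⇔ ShuffleOcc Q p₁ u') (sym (↓-lift β)) (sym (↓-lift (H β))) (H-shuffle β)
  transformFrom-shuffle β (γ ∷ γs) with hit? β
  ... | yes o = begin
    ShuffleOcc P p₁ (↓ (join (β ∷ γ ∷ γs)))
      ∼⟨ shuffle-join-hit β γ γs o ⟩
    (ShuffleOcc P p₁ (↓ β) ⊎ Occurs p₁ K (↓ (join (γ ∷ γs))))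
      ∼⟨ H-shuffle β ⊎-⇔ ⇔-id _ ⟩
    (ShuffleOcc Q p₁ (↓ (H β)) ⊎ Occurs p₁ K (↓ (join (γ ∷ γs))))
      ∼⟨ ⇔-sym (shuffle-join-hit (H β) γ γs (Equivalence.to (H-occ β) o)) ⟩
    ShuffleOcc Q p₁ (↓ (join (H β ∷ γ ∷ γs)))
      ∎
    where open EquationalReasoning
  ... | no ¬o = begin
    ShuffleOcc P p₁ (↓ (join (β ∷ γ ∷ γs)))
      ∼⟨ shuffle-join-miss β γ γs ¬o ⟩
    ShuffleOcc P p₁ (↓ (join (γ ∷ γs)))
      ∼⟨ transformFrom-shuffle γ γs ⟩
    ShuffleOcc Q p₁ (↓ (join rest))
      ∼⟨ ⇔-sym (shuffle-join-miss (F β) (head rest) (tail rest) (¬o ∘ Equivalence.from (F-occ β))) ⟩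
    ShuffleOcc Q p₁ (↓ (join (F β ∷⁺ rest)))
      ∎
    where
    open EquationalReasoning
    rest : List⁺ (List (Fin K))
    rest = transformFrom γ γs

  transform-shuffle : ∀ w → ShuffleOcc P p₁ (↓ w) ⇔ ShuffleOcc Q p₁ (↓ (transform w))
  transform-shuffle w = subst (λ u → ShuffleOcc P p₁ (↓ u) ⇔ ShuffleOcc Q p₁ (↓ (transform w))) (join-split w)
    (transformFrom-shuffle (head (split w)) (tail (split w)))

-- Replacing one factor of a shuffle pattern

shuffle⇒occurs-below : ∀ {K r₀ r₁} {p₀ : Fin r₀ → ℕ} {p₁ : Fin r₁ → ℕ} (β : List (Fin K)) →
                       ShuffleOcc p₀ p₁ (↓ β) → Occurs p₀ K (↓ β)
shuffle⇒occurs-below β c = proj₁ (shuffle⇒occurs (↓ β) (All.map ℕ.<⇒≤ (↓-< β)) c)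

module _ {r₀ r₀' r₁ : ℕ} {P : Fin r₀ → ℕ} {Q : Fin r₀' → ℕ} {p₁ : Fin r₁ → ℕ} where

  JointBij : ℕ → Set
  JointBij K = Σ[ H ∈ WordBij K (Occurs P K) (Occurs Q K) ]
               ∀ β → ShuffleOcc P p₁ (↓ β) ⇔ ShuffleOcc Q p₁ (↓ (to (bij H) β))

  jointBij : ∀ {K} → WordBij K (Occurs P K) (Occurs Q K) → WordBij K (ShuffleOcc P p₁) (ShuffleOcc Q p₁) → JointBij K
  jointBij {K} F G
    with harmonise length length-fibre-finite
           (λ β → occurs? P K (↓ β)) (λ β → shuffleOcc? P p₁ (↓ β))
           (λ β → occurs? Q K (↓ β)) (λ β → shuffleOcc? Q p₁ (↓ β))
           (shuffle⇒occurs-below _) (shuffle⇒occurs-below _)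
           (bij F) (length-pres F) (transport F) (bij G) (length-pres G) (transport G)
  ... | H , H-props =
      record { bij = H ; length-pres = proj₁ ∘ H-props ; transport = proj₁ ∘ proj₂ ∘ H-props }
    , proj₂ ∘ proj₂ ∘ H-props

  blockwiseBij : ∀ {K} (F : WordBij K (Occurs P K) (Occurs Q K)) → JointBij K →
                 WordBij (suc K) (ShuffleOcc P p₁) (ShuffleOcc Q p₁)
  blockwiseBij {K} F (H , H-shuffle) = record
    { bij = mk↔ₛ′ T.transform T⁻¹.transform
        (transform-inverse Q-hit? P-hit? (transport (wordBij-sym F)) (transport (wordBij-sym H))
                           (strictlyInverseˡ (bij F)) (strictlyInverseˡ (bij H)))
        (transform-inverse P-hit? Q-hit? (transport F) (transport H)
                           (strictlyInverseʳ (bij F)) (strictlyInverseʳ (bij H)))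
    ; length-pres = T.length-transform (length-pres F) (length-pres H)
    ; transport = transform-shuffle P-hit? (transport F) (transport H) H-shuffle
    }
    where
    P-hit? : ∀ β → Dec (Occurs P K (↓ β))
    P-hit? β = occurs? P K (↓ β)
    Q-hit? : ∀ β → Dec (Occurs Q K (↓ β))
    Q-hit? β = occurs? Q K (↓ β)
    module T = Transform P-hit? (to (bij F)) (to (bij H))
    module T⁻¹ = Transform Q-hit? (from (bij F)) (from (bij H))

  shuffleBij-left : (∀ k → WordBij k (Occurs P k) (Occurs Q k)) → ∀ k → WordBij k (ShuffleOcc P p₁) (ShuffleOcc Q p₁)
  shuffleBij-left occBij zero = record
    { bij = ↔-refl
    ; length-pres = λ _ → refl
    ; transport = λ w → mk⇔ (⊥-elim ∘ no-shuffle w) (⊥-elim ∘ no-shuffle w)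
    }
    where
    no-shuffle : ∀ {r r'} {p : Fin r → ℕ} {q : Fin r' → ℕ} (w : List (Fin 0)) → ¬ ShuffleOcc p q (↓ w)
    no-shuffle [] (shuffleOcc [] _ _ () _ _)
    no-shuffle [] (shuffleOcc (_ ∷ _) _ _ () _ _)
  shuffleBij-left occBij (suc K) = blockwiseBij (occBij K) (jointBij (occBij K) (shuffleBij-left occBij K))

shuffleBij-right : ∀ {r₀ r₁ r₁'} {p₀ : Fin r₀ → ℕ} {p₁ : Fin r₁ → ℕ} {q₁ : Fin r₁' → ℕ} →
  (∀ k → WordBij k (Occurs p₁ k) (Occurs q₁ k)) → ∀ k → WordBij k (ShuffleOcc p₀ p₁) (ShuffleOcc p₀ q₁)
shuffleBij-right {p₁ = p₁} {q₁} occBij k =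
  wordBij-trans (wordBij-reverse λ _ → shuffleOcc-reverse-⇔)
    (wordBij-trans (shuffleBij-left reversedBij k) (wordBij-reverse⁻ λ _ → shuffleOcc-reverse-⇔))
  where
  reversedBij : ∀ k → WordBij k (Occurs (p₁ ∘ opposite) k) (Occurs (q₁ ∘ opposite) k)
  reversedBij k = wordBij-trans (wordBij-reverse⁻ λ _ → occurs-reverse-⇔)
                    (wordBij-trans (occBij k) (wordBij-reverse λ _ → occurs-reverse-⇔))

shuffleBij-trivial : ∀ {r₀ r₁ m₀ m₁} (τ⁰ : Fin r₀ → Fin m₀) (τ¹ : Fin r₁ → Fin m₁) (f₁ f₂ : TrivBij) k →
  WordBij k (ShuffleOcc (pat τ⁰) (pat τ¹)) (ShuffleOcc (pat (applyTB f₁ τ⁰)) (pat (applyTB f₂ τ¹)))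
shuffleBij-trivial τ⁰ τ¹ f₁ f₂ k =
  wordBij-trans (shuffleBij-left (λ _ → trivialBij f₁ τ⁰) k) (shuffleBij-right (λ _ → trivialBij f₂ τ¹) k)

-- Occurrences by positions

record Window {r : ℕ} (p : Fin r → ℕ) (v : ℕ) (w : List ℕ) (s : ℕ) : Set where
  constructor window
  field
    ord-≡ : ∀ i j → ord (p i) (p j) ≡ ord (at w (s + toℕ i)) (at w (s + toℕ j))
    below : ∀ (i : Fin r) → at w (s + toℕ i) < v

module _ {r : ℕ} {p : Fin r → ℕ} {v : ℕ} where

  window-transfer : ∀ {w w' s s'} → (∀ (i : Fin r) → at w' (s' + toℕ i) ≡ at w (s + toℕ i)) →
                    Window p v w s → Window p v w' s'
  window-transfer same (window ord-≡ below) =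
    window (λ i j → trans (ord-≡ i j) (sym (cong₂ ord (same i) (same j)))) (λ i → subst (_< v) (sym (same i)) (below i))

  window-++ˡ : ∀ {xs ys s} → s + r ≤ length xs → Window p v xs s → Window p v (xs ++ ys) s
  window-++ˡ {xs} {ys} {s} fits = window-transfer λ i → at-++ˡ xs ys (ℕ.<-≤-trans (ℕ.+-monoʳ-< s (toℕ<n i)) fits)

  window-++ʳ : ∀ {xs ys s} → Window p v ys s → Window p v (xs ++ ys) (length xs + s)
  window-++ʳ {xs} {ys} {s} = window-transfer λ i →
    trans (cong (at (xs ++ ys)) (ℕ.+-assoc (length xs) s (toℕ i))) (at-++ʳ xs ys (s + toℕ i))

  window-take : ∀ {w s b} → s + r ≤ b → Window p v w s → Window p v (take b w) s
  window-take {w} {s} fits = window-transfer λ i → at-take w (ℕ.<-≤-trans (ℕ.+-monoʳ-< s (toℕ<n i)) fits)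

  window-drop : ∀ {w s b} → Window p v w (b + s) → Window p v (drop b w) s
  window-drop {w} {s} {b} = window-transfer λ i →
    trans (at-drop b w (s + toℕ i)) (cong (at w) (sym (ℕ.+-assoc b s (toℕ i))))

  occurs⇒window : ∀ {w} → Occurs p v w → ∃[ s ] s + r ≤ length w × Window p v w s
  occurs⇒window (occurs α u β refl (orderIso refl ord-≡) below) =
    length α + 0 , fits ,
    window-++ʳ {xs = α} (window-++ˡ {xs = u} {ys = β} ℕ.≤-refl (window ord-≡ (λ i → All-at below (toℕ<n i))))
    where
    fits : length α + 0 + length u ≤ length (α ++ u ++ β)
    fits = begin
      length α + 0 + length u           ≡⟨ cong (_+ length u) (ℕ.+-identityʳ (length α)) ⟩
      length α + length u               ≤⟨ ℕ.+-monoʳ-≤ (length α) (ℕ.m≤m+n (length u) (length β)) ⟩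
      length α + (length u + length β)  ≡⟨ cong (length α +_) (length-++ u) ⟨
      length α + length (u ++ β)        ≡⟨ length-++ α ⟨
      length (α ++ u ++ β)              ∎
      where open ℕ.≤-Reasoning

  window⇒occurs : ∀ {w s} → s + r ≤ length w → Window p v w s → Occurs p v w
  window⇒occurs {w} {s} fits win
    with window-take {b = r} ℕ.≤-refl (window-drop {b = s} (subst (Window p v w) (sym (ℕ.+-identityʳ s)) win))
  ... | window ord-≡ below =
    occurs (take s w) u (drop r (drop s w)) factorisation (orderIso length-u ord-≡) (All-from-at length-u below)
    where
    u : List ℕ
    u = take r (drop s w)
    factorisation : w ≡ take s w ++ u ++ drop r (drop s w)
    factorisation = sym (trans (cong (take s w ++_) (take++drop≡id r (drop s w))) (take++drop≡id s w))
    length-u : length u ≡ r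
    length-u = trans (length-take r (drop s w)) (ℕ.m≤n⇒m⊓n≡m (subst (r ≤_) (sym (length-drop s w))
                 (ℕ.m+n≤o⇒m≤o∸n r (subst (_≤ length w) (ℕ.+-comm s r) fits))))

record ShuffleAt {r₀ r₁ : ℕ} (p₀ : Fin r₀ → ℕ) (p₁ : Fin r₁ → ℕ) (w : List ℕ) : Set where
  constructor shuffleAt
  field
    start₀ peak start₁ : ℕ
    fits₀ : start₀ + r₀ ≤ peak
    peak<start₁ : peak < start₁
    fits₁ : start₁ + r₁ ≤ length w
    window₀ : Window p₀ (at w peak) w start₀
    window₁ : Window p₁ (at w peak) w start₁

module _ {r₀ r₁ : ℕ} {p₀ : Fin r₀ → ℕ} {p₁ : Fin r₁ → ℕ} where

  shuffleOcc⇒shuffleAt : ∀ {w} → ShuffleOcc p₀ p₁ w → ShuffleAt p₀ p₁ w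
  shuffleOcc⇒shuffleAt (shuffleOcc α x β refl o₀ o₁) with occurs⇒window o₀ | occurs⇒window o₁
  ... | s₀ , fits₀ , win₀ | t , fits₁ , win₁ =
    shuffleAt s₀ (length α) (length α + suc t) fits₀ (ℕ.m<m+n (length α) (s≤s z≤n)) fits
      (at-peak (window-++ˡ {ys = x ∷ β} fits₀ win₀))
      (at-peak (window-++ʳ {xs = α} (window-transfer {w = β} {s = t} (λ _ → refl) win₁)))
    where
    at-peak : ∀ {r} {p : Fin r → ℕ} {s} →
              Window p x (α ++ x ∷ β) s → Window p (at (α ++ x ∷ β) (length α)) (α ++ x ∷ β) s
    at-peak {p = p} {s} = subst (λ y → Window p y (α ++ x ∷ β) s) (sym (at-++-∷ α))
    fits : length α + suc t + r₁ ≤ length (α ++ x ∷ β)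
    fits = begin
      length α + suc t + r₁      ≡⟨ ℕ.+-assoc (length α) (suc t) r₁ ⟩
      length α + suc (t + r₁)    ≤⟨ ℕ.+-monoʳ-≤ (length α) (s≤s fits₁) ⟩
      length α + length (x ∷ β)  ≡⟨ length-++ α ⟨
      length (α ++ x ∷ β)        ∎
      where open ℕ.≤-Reasoning

  shuffleAt⇒shuffleOcc : ∀ {w} → ShuffleAt p₀ p₁ w → ShuffleOcc p₀ p₁ w
  shuffleAt⇒shuffleOcc {w} (shuffleAt s₀ b s₁ fits₀ b<s₁ fits₁ win₀ win₁) =
    shuffleOcc (take b w) (at w b) (drop (suc b) w) (++-∷-at w b<w)
      (window⇒occurs (subst (s₀ + r₀ ≤_) (sym length-take-b) fits₀) (window-take fits₀ win₀))
      (window⇒occurs fits-drop (window-drop {b = suc b} (subst (Window p₁ (at w b) w) s₁≡ win₁)))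
    where
    b<w : b < length w
    b<w = ℕ.<-≤-trans b<s₁ (ℕ.m+n≤o⇒m≤o s₁ fits₁)
    length-take-b : length (take b w) ≡ b
    length-take-b = trans (length-take b w) (ℕ.m≤n⇒m⊓n≡m (ℕ.<⇒≤ b<w))
    s₁≡ : s₁ ≡ suc b + (s₁ ∸ suc b)
    s₁≡ = sym (ℕ.m+[n∸m]≡n b<s₁)
    fits-drop : s₁ ∸ suc b + r₁ ≤ length (drop (suc b) w)
    fits-drop = begin
      s₁ ∸ suc b + r₁          ≡⟨ ℕ.+-∸-comm r₁ b<s₁ ⟨
      s₁ + r₁ ∸ suc b          ≤⟨ ℕ.∸-monoˡ-≤ (suc b) fits₁ ⟩
      length w ∸ suc b         ≡⟨ length-drop (suc b) w ⟨
      length (drop (suc b) w)  ∎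
      where open ℕ.≤-Reasoning

  shuffleOcc⇔shuffleAt : ∀ {w} → ShuffleOcc p₀ p₁ w ⇔ ShuffleAt p₀ p₁ w
  shuffleOcc⇔shuffleAt = mk⇔ shuffleOcc⇒shuffleAt shuffleAt⇒shuffleOcc

consecutive⇒translate : ∀ {r} (P : Fin r → ℕ) {lo hi} → lo ≤ hi → (∀ q → lo ≤ P q) → (∀ q → P q < hi) →
  (∀ q q' → toℕ q' ≡ suc (toℕ q) → P q' ≡ suc (P q)) →
  Σ[ s ∈ ℕ ] (∀ q → P q ≡ s + toℕ q) × lo ≤ s × s + r ≤ hi
consecutive⇒translate {zero} P {lo} lo≤hi _ _ _ =
  lo , (λ ()) , ℕ.≤-refl , subst (_≤ _) (sym (ℕ.+-identityʳ lo)) lo≤hi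
consecutive⇒translate {suc r} P {hi = hi} _ lo≤P P<hi step = P zero , translate , lo≤P zero , fits
  where
  translate-at : ∀ j (j<1+r : j < suc r) → P (fromℕ< j<1+r) ≡ P zero + j
  translate-at zero _ = sym (ℕ.+-identityʳ _)
  translate-at (suc j) 1+j<1+r =
    trans (step (fromℕ< j<1+r) (fromℕ< 1+j<1+r) (trans (toℕ-fromℕ< 1+j<1+r) (cong suc (sym (toℕ-fromℕ< j<1+r)))))
          (trans (cong suc (translate-at j j<1+r)) (sym (ℕ.+-suc _ j)))
    where
    j<1+r : j < suc r
    j<1+r = ℕ.<-trans (ℕ.n<1+n j) 1+j<1+r
  translate : ∀ q → P q ≡ P zero + toℕ q
  translate q = trans (cong P (sym (fromℕ<-toℕ q (toℕ<n q)))) (translate-at (toℕ q) (toℕ<n q))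
  fits : P zero + suc r ≤ hi
  fits = subst (_≤ hi) (sym (ℕ.+-suc (P zero) r))
    (subst (_< hi) (trans (translate (fromℕ r)) (cong (P zero +_) (toℕ-fromℕ r))) (P<hi (fromℕ r)))

<ᵇ⇔< : ∀ {m n} → T (m <ᵇ n) ⇔ m < n
<ᵇ⇔< {m} {n} = mk⇔ (ℕ.<ᵇ⇒< m n) ℕ.<⇒<ᵇ

at-↓-toList : ∀ {k n} (σ : Vec (Fin k) n) (i : Fin n) → at (↓ (toList σ)) (toℕ i) ≡ toℕ (lookup σ i)
at-↓-toList (c ∷ σ) zero = refl
at-↓-toList (c ∷ σ) (suc i) = at-↓-toList σ i

length-↓-toList : ∀ {k n} (σ : Vec (Fin k) n) → length (↓ (toList σ)) ≡ n
length-↓-toList σ = trans (length-map toℕ (toList σ)) (length-toList σ)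

module _ {r₀ r₁ m₀ m₁ : ℕ} (τ⁰ : Fin r₀ → Fin m₀) (τ¹ : Fin r₁ → Fin m₁) where

  private
    φ : POGP
    φ = shuffle τ⁰ τ¹

  data Slot : Fin (r₀ + suc r₁) → Set where
    ‵left : (q : Fin r₀) → Slot (q ↑ˡ suc r₁)
    ‵top : Slot (r₀ ↑ʳ zero)
    ‵right : (q : Fin r₁) → Slot (r₀ ↑ʳ suc q)

  slot : ∀ i → Slot i
  slot i with splitAt r₀ {suc r₁} i in eq
  ... | inj₁ q = subst Slot (splitAt⁻¹-↑ˡ eq) (‵left q)
  ... | inj₂ zero = subst Slot (splitAt⁻¹-↑ʳ eq) ‵top
  ... | inj₂ (suc q) = subst Slot (splitAt⁻¹-↑ʳ eq) (‵right q)

  index : ∀ {i} → Slot i → ℕ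
  index (‵left q) = toℕ q
  index ‵top = r₀
  index (‵right q) = r₀ + suc (toℕ q)

  toℕ-slot : ∀ {i} (s : Slot i) → toℕ i ≡ index s
  toℕ-slot (‵left q) = toℕ-↑ˡ q (suc r₁)
  toℕ-slot ‵top = trans (toℕ-↑ʳ r₀ zero) (ℕ.+-identityʳ r₀)
  toℕ-slot (‵right q) = toℕ-↑ʳ r₀ (suc q)

  slot-letter : ∀ {i} → Slot i → SLetter
  slot-letter (‵left q) = left (toℕ (τ⁰ q))
  slot-letter ‵top = top
  slot-letter (‵right q) = right (toℕ (τ¹ q))

  letter-slot : ∀ {i} (s : Slot i) → letter φ i ≡ slot-letter s
  letter-slot (‵left q) rewrite splitAt-↑ˡ r₀ q (suc r₁) = refl
  letter-slot ‵top rewrite splitAt-↑ʳ r₀ (suc r₁) (zero {r₁}) = refl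
  letter-slot (‵right q) rewrite splitAt-↑ʳ r₀ (suc r₁) (suc q) = refl

  glued-slot : ∀ {i} (s : Slot i) → glued φ i ≡ true ⇔ (suc (index s) < r₀ ⊎ r₀ < index s)
  glued-slot {i} s = subst (λ x → glued φ i ≡ true ⇔ (suc x < r₀ ⊎ r₀ < x)) (toℕ-slot s)
    ((<ᵇ⇔< ⊎-⇔ <ᵇ⇔<) ⇔-∘ (T-∨ ⇔-∘ ⇔-sym T-≡))

  glued-left : ∀ q → glued φ (q ↑ˡ suc r₁) ≡ true ⇔ suc (toℕ q) < r₀
  glued-left q = mk⇔
    ([ id , (λ r₀<q → ⊥-elim (ℕ.<-asym r₀<q (toℕ<n q))) ] ∘ Equivalence.to (glued-slot (‵left q)))
    (Equivalence.from (glued-slot (‵left q)) ∘ inj₁)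

  glued-top : glued φ (r₀ ↑ʳ zero) ≢ true
  glued-top = [ (λ 1+r₀<r₀ → ℕ.<-asym 1+r₀<r₀ (ℕ.n<1+n r₀)) , ℕ.<-irrefl refl ]
            ∘ Equivalence.to (glued-slot ‵top)

  glued-right : ∀ q → glued φ (r₀ ↑ʳ suc q) ≡ true
  glued-right q = Equivalence.from (glued-slot (‵right q)) (inj₂ (ℕ.m<m+n r₀ (s≤s z≤n)))

  module _ {k n : ℕ} (σ : Vec (Fin k) n) where

    private
      w : List ℕ
      w = ↓ (toList σ)

    module _ (occ : ShuffleAt (pat τ⁰) (pat τ¹) w) where

      open ShuffleAt occ renaming (start₀ to s₀; peak to b; start₁ to s₁)

      private
        left<peak : ∀ (q : Fin r₀) → s₀ + toℕ q < b
        left<peak q = ℕ.<-≤-trans (ℕ.+-monoʳ-< s₀ (toℕ<n q)) fits₀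

        peak<right : ∀ (q : Fin r₁) → b < s₁ + toℕ q
        peak<right q = ℕ.<-≤-trans peak<start₁ (ℕ.m≤m+n s₁ (toℕ q))

        right-fits : s₁ + r₁ ≤ n
        right-fits = subst (s₁ + r₁ ≤_) (length-↓-toList σ) fits₁

        pos : ∀ {i} → Slot i → ℕ
        pos (‵left q) = s₀ + toℕ q
        pos ‵top = b
        pos (‵right q) = s₁ + toℕ q

        pos<n : ∀ {i} (s : Slot i) → pos s < n
        pos<n (‵left q) = ℕ.<-trans (left<peak q) (pos<n ‵top)
        pos<n ‵top = ℕ.<-≤-trans peak<start₁ (ℕ.m+n≤o⇒m≤o s₁ right-fits)
        pos<n (‵right q) = ℕ.<-≤-trans (ℕ.+-monoʳ-< s₁ (toℕ<n q)) right-fits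

        ι : Fin (r₀ + suc r₁) → Fin n
        ι i = fromℕ< (pos<n (slot i))

        toℕ-ι : ∀ i → toℕ (ι i) ≡ pos (slot i)
        toℕ-ι i = toℕ-fromℕ< (pos<n (slot i))

        value : ∀ i → at w (pos (slot i)) ≡ toℕ (lookup σ (ι i))
        value i = trans (cong (at w) (sym (toℕ-ι i))) (at-↓-toList σ (ι i))

        pos-mono : ∀ {i j} (si : Slot i) (sj : Slot j) → index si < index sj → pos si < pos sj
        pos-mono (‵left q) (‵left q') q<q' = ℕ.+-monoʳ-< s₀ q<q'
        pos-mono (‵left q) ‵top _ = left<peak q
        pos-mono (‵left q) (‵right q') _ = ℕ.<-trans (left<peak q) (peak<right q')
        pos-mono ‵top (‵left q) r₀<q = ⊥-elim (ℕ.<-asym r₀<q (toℕ<n q))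
        pos-mono ‵top ‵top r₀<r₀ = ⊥-elim (ℕ.<-irrefl refl r₀<r₀)
        pos-mono ‵top (‵right q) _ = peak<right q
        pos-mono (‵right q) (‵left q') h = ⊥-elim (ℕ.<-asym (ℕ.≤-<-trans (ℕ.m≤m+n r₀ _) h) (toℕ<n q'))
        pos-mono (‵right q) ‵top h = ⊥-elim (ℕ.<-asym h (ℕ.m<m+n r₀ (s≤s z≤n)))
        pos-mono (‵right q) (‵right q') h = ℕ.+-monoʳ-< s₁ (s≤s⁻¹ (ℕ.+-cancelˡ-< r₀ _ _ h))

        pos-glue : ∀ {i j} (si : Slot i) (sj : Slot j) → index sj ≡ suc (index si) → glued φ i ≡ true →
                   pos sj ≡ suc (pos si)
        pos-glue (‵left q) (‵left q') e _ = trans (cong (s₀ +_) e) (ℕ.+-suc s₀ (toℕ q))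
        pos-glue (‵left q) ‵top e g = ⊥-elim (ℕ.<-irrefl (sym e) (Equivalence.to (glued-left q) g))
        pos-glue (‵left q) (‵right q') e g =
          ⊥-elim (ℕ.<-irrefl (sym e) (ℕ.<-≤-trans (Equivalence.to (glued-left q) g) (ℕ.m≤m+n r₀ _)))
        pos-glue ‵top _ _ g = ⊥-elim (glued-top g)
        pos-glue (‵right q) (‵left q') e _ = ⊥-elim (ℕ.<-irrefl e (ℕ.<-trans (toℕ<n q') (s≤s (ℕ.m≤m+n r₀ _))))
        pos-glue (‵right q) ‵top e _ = ⊥-elim (ℕ.<-irrefl e (s≤s (ℕ.m≤m+n r₀ _)))
        pos-glue (‵right q) (‵right q') e _ =
          trans (cong (s₁ +_) (ℕ.suc-injective (ℕ.+-cancelˡ-≡ r₀ _ _ (trans e (sym (ℕ.+-suc r₀ (suc (toℕ q))))))))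
                (ℕ.+-suc s₁ (toℕ q))

        pos-cmp : ∀ {i j} (si : Slot i) (sj : Slot j) o → cmpS (slot-letter si) (slot-letter sj) ≡ just o →
                  Holds o (at w (pos si)) (at w (pos sj))
        pos-cmp (‵left q) (‵left q') o c =
          subst (λ o → Holds o _ _) (trans (sym (Window.ord-≡ window₀ q q')) (just-injective c)) (holds-ord _ _)
        pos-cmp (‵left q) ‵top _ refl = Window.below window₀ q
        pos-cmp ‵top (‵left q) _ refl = Window.below window₀ q
        pos-cmp ‵top ‵top _ refl = refl
        pos-cmp ‵top (‵right q) _ refl = Window.below window₁ q
        pos-cmp (‵right q) ‵top _ refl = Window.below window₁ q
        pos-cmp (‵right q) (‵right q') o c =
          subst (λ o → Holds o _ _) (trans (sym (Window.ord-≡ window₁ q q')) (just-injective c)) (holds-ord _ _)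

      shuffleAt⇒contains : Contains φ σ
      shuffleAt⇒contains =
          ι
        , (λ i j i<j → subst₂ _<_ (sym (toℕ-ι i)) (sym (toℕ-ι j))
                         (pos-mono (slot i) (slot j) (subst₂ _<_ (toℕ-slot (slot i)) (toℕ-slot (slot j)) i<j)))
        , (λ i j j≡1+i g → trans (toℕ-ι j) (trans (pos-glue (slot i) (slot j)
                             (subst₂ (λ x y → y ≡ suc x) (toℕ-slot (slot i)) (toℕ-slot (slot j)) j≡1+i) g)
                             (cong suc (sym (toℕ-ι i)))))
        , (λ i j o c → subst₂ (Holds o) (value i) (value j) (pos-cmp (slot i) (slot j) o
                         (subst₂ (λ x y → cmpS x y ≡ just o) (letter-slot (slot i)) (letter-slot (slot j)) c)))

    module _ (contains : Contains φ σ) where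

      private
        ι : Fin (r₀ + suc r₁) → Fin n
        ι = proj₁ contains

        V : Fin (r₀ + suc r₁) → ℕ
        V i = toℕ (lookup σ (ι i))

        b : ℕ
        b = toℕ (ι (r₀ ↑ʳ zero))

        posₗ : Fin r₀ → ℕ
        posₗ q = toℕ (ι (q ↑ˡ suc r₁))

        posᵣ : Fin r₁ → ℕ
        posᵣ q = toℕ (ι (r₀ ↑ʳ suc q))

        slot-mono : ∀ {i j} (si : Slot i) (sj : Slot j) → index si < index sj → toℕ (ι i) < toℕ (ι j)
        slot-mono si sj h = proj₁ (proj₂ contains) _ _ (subst₂ _<_ (sym (toℕ-slot si)) (sym (toℕ-slot sj)) h)

        slot-glue : ∀ {i j} (si : Slot i) (sj : Slot j) → index sj ≡ suc (index si) → glued φ i ≡ true →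
                    toℕ (ι j) ≡ suc (toℕ (ι i))
        slot-glue si sj e =
          proj₁ (proj₂ (proj₂ contains)) _ _ (trans (toℕ-slot sj) (trans e (cong suc (sym (toℕ-slot si)))))

        slot-cmp : ∀ {i j} (si : Slot i) (sj : Slot j) {o} → cmpS (slot-letter si) (slot-letter sj) ≡ just o →
                   Holds o (V i) (V j)
        slot-cmp si sj {o} c = proj₂ (proj₂ (proj₂ contains)) _ _ o
          (subst₂ (λ x y → cmpS x y ≡ just o) (sym (letter-slot si)) (sym (letter-slot sj)) c)

        left<peak : ∀ q → posₗ q < b
        left<peak q = slot-mono (‵left q) ‵top (toℕ<n q)

        peak<right : ∀ q → suc b ≤ posᵣ q
        peak<right q = slot-mono ‵top (‵right q) (ℕ.m<m+n r₀ (s≤s z≤n))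

        stepₗ : ∀ q q' → toℕ q' ≡ suc (toℕ q) → posₗ q' ≡ suc (posₗ q)
        stepₗ q q' e = slot-glue (‵left q) (‵left q') e (Equivalence.from (glued-left q) (subst (_< r₀) e (toℕ<n q')))

        stepᵣ : ∀ q q' → toℕ q' ≡ suc (toℕ q) → posᵣ q' ≡ suc (posᵣ q)
        stepᵣ q q' e =
          slot-glue (‵right q) (‵right q') (trans (cong (λ x → r₀ + suc x) e) (ℕ.+-suc r₀ _)) (glued-right q)

        at-ι : ∀ i {x} → toℕ (ι i) ≡ x → at w x ≡ V i
        at-ι i refl = at-↓-toList σ (ι i)

      contains⇒shuffleAt : ShuffleAt (pat τ⁰) (pat τ¹) w
      contains⇒shuffleAt
        with consecutive⇒translate posₗ z≤n (λ _ → z≤n) left<peak stepₗ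
           | consecutive⇒translate posᵣ (toℕ<n (ι (r₀ ↑ʳ zero))) peak<right
                                   (λ q → toℕ<n (ι (r₀ ↑ʳ suc q))) stepᵣ
      ... | s₀ , posₗ≡ , _ , fits₀ | s₁ , posᵣ≡ , b<s₁ , fits₁ =
        shuffleAt s₀ b s₁ fits₀ b<s₁ (subst (s₁ + r₁ ≤_) (sym (length-↓-toList σ)) fits₁)
          (window (λ q q' → sym (trans (cong₂ ord (at-left q) (at-left q'))
                                       (holds⇒ord (slot-cmp (‵left q) (‵left q') refl))))
                  (λ q → subst₂ _<_ (sym (at-left q)) (sym (at-ι _ refl)) (slot-cmp (‵left q) ‵top refl)))
          (window (λ q q' → sym (trans (cong₂ ord (at-right q) (at-right q'))
                                       (holds⇒ord (slot-cmp (‵right q) (‵right q') refl))))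
                  (λ q → subst₂ _<_ (sym (at-right q)) (sym (at-ι _ refl)) (slot-cmp (‵right q) ‵top refl)))
        where
        at-left : ∀ q → at w (s₀ + toℕ q) ≡ V (q ↑ˡ suc r₁)
        at-left q = at-ι _ (posₗ≡ q)
        at-right : ∀ q → at w (s₁ + toℕ q) ≡ V (r₀ ↑ʳ suc q)
        at-right q = at-ι _ (posᵣ≡ q)

contains⇔shuffleOcc : ∀ {r₀ r₁ m₀ m₁ k n} (τ⁰ : Fin r₀ → Fin m₀) (τ¹ : Fin r₁ → Fin m₁) (σ : Vec (Fin k) n) →
  Contains (shuffle τ⁰ τ¹) σ ⇔ ShuffleOcc (pat τ⁰) (pat τ¹) (↓ (toList σ))
contains⇔shuffleOcc τ⁰ τ¹ σ =
  ⇔-sym shuffleOcc⇔shuffleAt ⇔-∘ mk⇔ (contains⇒shuffleAt τ⁰ τ¹ σ) (shuffleAt⇒contains τ⁰ τ¹ σ)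

wordBij-Vec : ∀ {k A B} → WordBij k A B → ∀ n →
  Σ[ g ∈ Vec (Fin k) n ↔ Vec (Fin k) n ] ∀ σ → A (↓ (toList σ)) ⇔ B (↓ (toList (to g σ)))
wordBij-Vec {k} {A} {B} W n = g , λ σ →
  subst (λ u → A (↓ (toList σ)) ⇔ B (↓ u)) (sym (toList-g σ)) (transport W (toList σ))
  where
  words-of-length : Fibre (length {A = Fin k}) n ↔ Fibre length n
  words-of-length = fibre-↔ ℕ._≟_ (bij W) (λ w → trans (length-pres W w)) (λ w → trans (length-pres (wordBij-sym W) w))
  g : Vec (Fin k) n ↔ Vec (Fin k) n
  g = ↔-trans Vec↔List (↔-trans words-of-length (↔-sym Vec↔List))
  toList-g : ∀ σ → toList (to g σ) ≡ to (bij W) (toList σ)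
  toList-g σ = cong proj₁ (strictlyInverseˡ Vec↔List (to words-of-length (to Vec↔List σ)))

mainTheorem4 : {r₀ r₁ m₀ m₁ : ℕ}
    (τ⁰ : Fin r₀ → Fin m₀) (τ¹ : Fin r₁ → Fin m₁) →
    IsGenPattern τ⁰ → IsGenPattern τ¹ →
    (f₁ f₂ : TrivBij) →
    shuffle τ⁰ τ¹ ≡ₚ shuffle (applyTB f₁ τ⁰) (applyTB f₂ τ¹)
mainTheorem4 τ⁰ τ¹ _ _ f₁ f₂ k n = g , λ σ → Equivalence.to (avoids⇔ σ) , Equivalence.from (avoids⇔ σ)
  where
  g : Vec (Fin k) n ↔ Vec (Fin k) n
  g = proj₁ (wordBij-Vec (shuffleBij-trivial τ⁰ τ¹ f₁ f₂ k) n)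

  contains⇔ : ∀ σ → Contains (shuffle τ⁰ τ¹) σ ⇔ Contains (shuffle (applyTB f₁ τ⁰) (applyTB f₂ τ¹)) (to g σ)
  contains⇔ σ = ⇔-sym (contains⇔shuffleOcc (applyTB f₁ τ⁰) (applyTB f₂ τ¹) (to g σ))
            ⇔-∘ (proj₂ (wordBij-Vec (shuffleBij-trivial τ⁰ τ¹ f₁ f₂ k) n) σ ⇔-∘ contains⇔shuffleOcc τ⁰ τ¹ σ)

  avoids⇔ : ∀ σ → Avoids (shuffle τ⁰ τ¹) σ ⇔ Avoids (shuffle (applyTB f₁ τ⁰) (applyTB f₂ τ¹)) (to g σ)
  avoids⇔ σ = ¬-cong-⇔ (contains⇔ σ)
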